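{- There is a constant $c$ such that for every $n\ge1$ there exists an algebraic circuit $C$ over $\mathbb{Q}$ with input variables $\{x_{ij}: i\in[n+1], j\in[n]\}$, of size at most $c\cdot3^n$, which is $(\mathrm{Sym}_{n+1}\times\mathrm{Sym}_n)$-symmetric and computes all polynomials $B_D$ for $D\subseteq[n+1]$, in the sense that for every $D\subseteq[n+1]$ there is a gate $g_D$ of $C$ whose output is $B_D$.
   Context: For $D\subseteq[n+1]$, $B_D:=\sum_{\gamma\colon D\hookrightarrow[n]}\prod_{i\in D}x_{i\gamma(i)}$, the sum over all injective maps $\gamma$ from $D$ to $[n]$ ($B_\emptyset=1$). An algebraic circuit over variables $Z$ and field $\mathbb{F}$ is a connected DAG whose in-degree-$0$ gates are labelled by elements of $Z\cup\mathbb{F}$ and whose other gates are labelled $+$ or $\times$ (arbitrary fan-in); each gate computes a polynomial in the obvious way; its size is its number of gates. $\mathrm{Sym}_{n+1}\times\mathrm{Sym}_n$ acts on the variables by $(\pi,\sigma)(x_{ij})=x_{\pi(i)\sigma(j)}$ (and trivially on constants); the circuit is symmetric under this group if each group element extends to an automorphism $\sigma'$ of the DAG preserving labels of internal gates and satisfying $\lambda(\sigma'(g))=(\pi,\sigma)(\lambda(g))$ for every input gate $g$. -}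

module Defs where

open import Data.Nat using (ℕ; zero; suc; _<_; _≤_)
open import Data.Fin using (Fin; toℕ)
open import Data.Fin.Permutation using (Permutation′; _⟨$⟩ʳ_)
open import Data.Bool using (Bool; true; false; if_then_else_)
open import Data.Vec using (Vec; lookup; _[_]≔_; replicate)
open import Data.List using (List; []; _∷_; allFin; foldr; filter)
open import Data.Product using (_×_; _,_)
open import Data.Sum using (_⊎_)
open import Data.Rational using (ℚ; 0ℚ; 1ℚ; _+_; _*_)
open import Relation.Binary.PropositionalEquality using (_≡_)
open import Relation.Binary.Construct.Closure.ReflexiveTransitive using (Star)
open import Relation.Nullary.Decidable using (does)
open import Data.Bool.Properties using (T?)

data Label (V : Set) : Set where
  var   : V → Label V
  const : ℚ → Label V
  plus  : Label V
  times : Label V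

isLeafLabel : ∀ {V} → Label V → Bool
isLeafLabel (var _)   = true
isLeafLabel (const _) = true
isLeafLabel plus      = false
isLeafLabel times     = false

-- A circuit with s gates (the gates are Fin s, so its size is s).
-- edge h g ≡ true means there is a wire from h into g (h is a child of g).
-- The DAG is presented with a topological numbering of its gates
-- (acyclic field); every DAG admits one.
record Circuit (V : Set) (s : ℕ) : Set where
  field
    label     : Fin s → Label V
    edge      : Fin s → Fin s → Bool
    acyclic   : ∀ h g → edge h g ≡ true → toℕ h < toℕ g
    leaf⇒inp  : ∀ g → (∀ h → edge h g ≡ false) → isLeafLabel (label g) ≡ true
    inp⇒leaf  : ∀ g → isLeafLabel (label g) ≡ true → ∀ h → edge h g ≡ false
    connected : ∀ g h → Star (λ u v → edge u v ≡ true ⊎ edge v u ≡ true) g h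

module _ {V : Set} {s : ℕ} (C : Circuit V s) (a : V → ℚ) where
  open Circuit C

  -- evaluation with fuel; fuel s suffices since the circuit is acyclic
  evalF : ℕ → Fin s → ℚ
  evalF zero    g = 0ℚ
  evalF (suc k) g with label g
  ... | var v   = a v
  ... | const q = q
  ... | plus    = foldr (λ h r → (if edge h g then evalF k h else 0ℚ) + r) 0ℚ (allFin s)
  ... | times   = foldr (λ h r → (if edge h g then evalF k h else 1ℚ) * r) 1ℚ (allFin s)

  eval : Fin s → ℚ
  eval g = evalF s g

Var : ℕ → Set
Var n = Fin (suc n) × Fin n

actVar : ∀ {n} → Permutation′ (suc n) → Permutation′ n → Var n → Var n
actVar π σ (i , j) = (π ⟨$⟩ʳ i , σ ⟨$⟩ʳ j)

actLabel : ∀ {n} → Permutation′ (suc n) → Permutation′ n → Label (Var n) → Label (Var n)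
actLabel π σ (var v)   = var (actVar π σ v)
actLabel π σ (const q) = const q
actLabel π σ plus      = plus
actLabel π σ times     = times

record ExtendsTo {n s : ℕ} (C : Circuit (Var n) s)
                 (π : Permutation′ (suc n)) (σ : Permutation′ n)
                 (τ : Permutation′ s) : Set where
  open Circuit C
  field
    edge-pres  : ∀ h g → edge (τ ⟨$⟩ʳ h) (τ ⟨$⟩ʳ g) ≡ edge h g
    label-pres : ∀ g → label (τ ⟨$⟩ʳ g) ≡ actLabel π σ (label g)

open import Data.Product using (Σ)

Symmetric : ∀ {n s} → Circuit (Var n) s → Set
Symmetric {n} {s} C =
  ∀ (π : Permutation′ (suc n)) (σ : Permutation′ n) →
    Σ (Permutation′ s) (ExtendsTo C π σ)

-- Sum over injective assignments of the rows in the list to columns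
-- not in `used`, of the product of the corresponding a i j.
injSum : ∀ {n m} → (Fin m → Fin n → ℚ) → List (Fin m) → Vec Bool n → ℚ
injSum {n} a []       used = 1ℚ
injSum {n} a (i ∷ is) used =
  foldr (λ j r → (if lookup used j then 0ℚ
                  else a i j * injSum a is (used [ j ]≔ true)) + r)
        0ℚ (allFin n)

elems : ∀ {m} → Vec Bool m → List (Fin m)
elems {m} D = filter (λ i → T? (lookup D i)) (allFin m)

-- B_D = Σ_{γ : D ↪ [n]} Π_{i ∈ D} x_{i γ(i)}, evaluated at a
B : ∀ {n} → Vec Bool (suc n) → (Var n → ℚ) → ℚ
B {n} D a = injSum (λ i j → a (i , j)) (elems D) (replicate n false)

{-# OPTIONS --safe #-}

-- Identify a function f on subsets of [m] with Σ_D f D e_D in the algebra where e_b e_c = e_(b ∪ c) for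
-- disjoint b, c and 0 otherwise, whose product is subset convolution ⋆. Then D ↦ B_D is the ⋆-product
-- over the columns j of the linear elements 1 + Σ_i x_ij e_{i}, and f ↦ |D| f is a derivation of ⋆ which
-- takes each linear factor L to L ⋆ ℓ, where ℓ b = (-1)^(|b|-1) |b|! Π_{i ∈ b} x_ij. Summing over the
-- columns gives Newton's identity
--   |D| B_D = Σ_{b ⊎ c = D, b ≠ ∅} (-1)^(|b|-1) |b|! p_b B_c,   where p_b = Σ_j Π_{i ∈ b} x_ij,
-- which computes each B_D from power sums and the B_c with c ⊊ D. The circuit has gates for the inputs,
-- the monomials Π_{i ∈ b} x_ij and the power sums p_b, and, for each word w ∈ {0,1,2}^(n+1) encoding a
-- split (b , c), a constant gate and a gate for the summand of the split (for B_c when b = ∅). These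
-- families are closed under Sym_{n+1} × Sym_n, which permutes letters and columns, and there are
-- O(3^n) gates.

module Submission where

module GateCount where
  open import Data.Nat using (ℕ; zero; suc; _+_; _*_; _^_; _≤_; z≤n; s≤s)
  open import Data.Nat.Properties using (≤-refl; ≤-trans; +-mono-≤; *-monoˡ-≤; *-monoʳ-≤; ^-monoˡ-≤; m^n>0; module ≤-Reasoning)
  open import Data.Nat.Solver using (module +-*-Solver)
  open import Relation.Binary.PropositionalEquality using (refl)
  open +-*-Solver using (solve; _:+_; _:*_; _:=_; con)

  2^≤3^ : ∀ k → 2 ^ k ≤ 3 ^ k
  2^≤3^ k = ^-monoˡ-≤ k (s≤s (s≤s z≤n))

  k*2^k≤2*3^k : ∀ k → k * 2 ^ k ≤ 2 * 3 ^ k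
  k*2^k≤2*3^k zero    = z≤n
  k*2^k≤2*3^k (suc k) = begin
      suc k * (2 * 2 ^ k)
    ≡⟨ solve 2 (λ k x → (con 1 :+ k) :* (con 2 :* x) := con 2 :* x :+ con 2 :* (k :* x)) refl k (2 ^ k) ⟩
      2 * 2 ^ k + 2 * (k * 2 ^ k)
    ≤⟨ +-mono-≤ (*-monoʳ-≤ 2 (2^≤3^ k)) (*-monoʳ-≤ 2 (k*2^k≤2*3^k k)) ⟩
      2 * 3 ^ k + 2 * (2 * 3 ^ k)
    ≡⟨ solve 1 (λ t → con 2 :* t :+ con 2 :* (con 2 :* t) := con 2 :* (con 3 :* t)) refl (3 ^ k) ⟩
      2 * (3 * 3 ^ k)
    ∎
    where open ≤-Reasoning

  1+k≤2^1+k : ∀ k → suc k ≤ 2 ^ suc k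
  1+k≤2^1+k zero    = s≤s z≤n
  1+k≤2^1+k (suc k) = begin
      suc (suc k)
    ≤⟨ +-mono-≤ (m^n>0 2 (suc k)) (1+k≤2^1+k k) ⟩
      2 ^ suc k + 2 ^ suc k
    ≡⟨ solve 1 (λ x → x :+ x := con 2 :* x) refl (2 ^ suc k) ⟩
      2 * 2 ^ suc k
    ∎
    where open ≤-Reasoning

  gateCount≤16*3^n : ∀ n → suc n * n + (2 ^ suc n * n + (2 ^ suc n + (3 ^ suc n + 3 ^ suc n))) ≤ 16 * 3 ^ n
  gateCount≤16*3^n n = begin
      suc n * n + (2 ^ suc n * n + (2 ^ suc n + (3 ^ suc n + 3 ^ suc n)))
    ≤⟨ +-mono-≤ (≤-trans (*-monoˡ-≤ n (1+k≤2^1+k n)) 2^1+n*n≤4*3^n)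
                (+-mono-≤ 2^1+n*n≤4*3^n (+-mono-≤ (*-monoʳ-≤ 2 (2^≤3^ n)) ≤-refl)) ⟩
      2 * (2 * 3 ^ n) + (2 * (2 * 3 ^ n) + (2 * 3 ^ n + (3 * 3 ^ n + 3 * 3 ^ n)))
    ≡⟨ solve 1 (λ t → con 2 :* (con 2 :* t) :+ (con 2 :* (con 2 :* t) :+ (con 2 :* t :+ (con 3 :* t :+ con 3 :* t)))
                      := con 16 :* t) refl (3 ^ n) ⟩
      16 * 3 ^ n
    ∎
    where
    open ≤-Reasoning
    2^1+n*n≤4*3^n : 2 ^ suc n * n ≤ 2 * (2 * 3 ^ n)
    2^1+n*n≤4*3^n = begin
        2 * 2 ^ n * n
      ≡⟨ solve 2 (λ x n → con 2 :* x :* n := con 2 :* (n :* x)) refl (2 ^ n) n ⟩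
        2 * (n * 2 ^ n)
      ≤⟨ *-monoʳ-≤ 2 (k*2^k≤2*3^k n) ⟩
        2 * (2 * 3 ^ n)
      ∎

open import Data.Nat as ℕ using (ℕ; zero; suc; _^_; _≡ᵇ_)
import Data.Nat.Properties as ℕ
open import Data.Fin.Patterns using (0F; 1F; 2F)
open import Data.Fin as Fin using (Fin; zero; suc; toℕ; _↑ˡ_; _↑ʳ_; splitAt; combine; remQuot)
open import Data.Fin.Properties using (toℕ<n; splitAt-↑ˡ; splitAt-↑ʳ; join-splitAt; remQuot-combine; combine-remQuot; toℕ-combine; combine-monoˡ-<; toℕ-↑ˡ; toℕ-↑ʳ)
open import Data.Sum using (_⊎_; inj₁; inj₂; [_,_]′)
open import Data.Product using (Σ; _×_; _,_; uncurry)
open import Algebra.Structures using (IsCommutativeMonoid)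
open import Relation.Binary.Definitions using (DecidableEquality)
open import Relation.Nullary.Decidable using (Dec; does; does-⇔; yes; dec-true)
open import Function.Bundles using (_⇔_; mk⇔)
open import Data.Fin.Subset using (Subset; ∣_∣) renaming (⊥ to ∅)
open import Data.Bool using (Bool; true; false; if_then_else_; not; _∧_)
open import Data.Vec as Vec using (Vec; []; _∷_; lookup; _[_]≔_; replicate)
open import Data.List as List using (List; []; _∷_; allFin; filter; tabulate)
open import Data.Bool.Properties using (T?; not-involutive)
open import Data.List.Relation.Unary.All using (All; []; _∷_)
open import Data.List.Relation.Unary.AllPairs using ([]; _∷_)
open import Data.List.Relation.Unary.Unique.Propositional using (Unique)
open import Data.List.Relation.Unary.Unique.Propositional.Properties using (allFin⁺)
open import Data.Vec.Properties using (≡-dec; lookup∘update; lookup∘update′; lookup-replicate; lookup∘tabulate; tabulate∘lookup; tabulate-cong; tabulate-∘; lookup-map)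
open import Data.Rational using (ℚ; 0ℚ; 1ℚ; _+_; _*_; -_; 1/_; NonZero; NonNegative)
open import Data.Rational.Properties
open import Data.Rational.Solver using (module +-*-Solver)
open import Algebra.Properties.Monoid.Mult +-0-monoid using (×-homo-+) renaming (_×_ to _·_)
open import Algebra.Bundles using (Monoid; CommutativeMonoid)
open import Level using (0ℓ)
import Algebra.Properties.CommutativeSemigroup as CommSemigroupProperties
import Algebra.Properties.CommutativeMonoid.Sum
open import Relation.Binary.PropositionalEquality
open import Data.Empty using (⊥-elim)
open import Relation.Binary.Construct.Closure.ReflexiveTransitive using (Star; ε; _◅_; _◅◅_; gmap; reverse)
open import Data.Fin.Permutation as Perm using (Permutation′; _⟨$⟩ʳ_; _⟨$⟩ˡ_; permutation)
open import Function using (_∘_; _$_; id)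
open import Defs
open +-*-Solver using (solve; _:+_; _:*_; :-_; _:=_; con)

module +-Props = CommSemigroupProperties (CommutativeMonoid.commutativeSemigroup +-0-commutativeMonoid)
module *-Props = CommSemigroupProperties (CommutativeMonoid.commutativeSemigroup *-1-commutativeMonoid)

fromℕ : ℕ → ℚ
fromℕ k = k · 1ℚ

fromℕ-+ : ∀ k l → fromℕ (k ℕ.+ l) ≡ fromℕ k + fromℕ l
fromℕ-+ = ×-homo-+ 1ℚ

fromℕ-nonNegative : ∀ k → NonNegative (fromℕ k)
fromℕ-nonNegative zero    = _
fromℕ-nonNegative (suc k) = nonNeg+nonNeg⇒nonNeg 1ℚ (fromℕ k) {{fromℕ-nonNegative k}}

fromℕ-suc-nonZero : ∀ k → NonZero (fromℕ (suc k))
fromℕ-suc-nonZero k = pos⇒nonZero (fromℕ (suc k)) {{pos+nonNeg⇒pos 1ℚ (fromℕ k) {{fromℕ-nonNegative k}}}}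

-- 1/k, with the junk value 0 at k = 0
recip : ℕ → ℚ
recip zero    = 0ℚ
recip (suc k) = 1/_ (fromℕ (suc k)) {{fromℕ-suc-nonZero k}}

recip-inverse : ∀ k → recip (suc k) * fromℕ (suc k) ≡ 1ℚ
recip-inverse k = *-inverseˡ (fromℕ (suc k)) {{fromℕ-suc-nonZero k}}

-- Subset convolution

SubsetFun : ℕ → Set
SubsetFun m = Subset m → ℚ

isEmpty : ∀ {m} → Subset m → Bool
isEmpty b = ∣ b ∣ ≡ᵇ 0

δ : ∀ {m} → SubsetFun m
δ D = if isEmpty D then 1ℚ else 0ℚ

∣D∣≡0⇒D≡∅ : ∀ {m} (D : Subset m) → ∣ D ∣ ≡ 0 → D ≡ ∅
∣D∣≡0⇒D≡∅ []          _     = refl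
∣D∣≡0⇒D≡∅ (false ∷ D) ∣D∣≡0 = cong (false ∷_) (∣D∣≡0⇒D≡∅ D ∣D∣≡0)

isEmpty-lookup : ∀ {k} (b : Subset k) → isEmpty b ≡ true → ∀ i → lookup b i ≡ false
isEmpty-lookup (false ∷ b) empty zero    = refl
isEmpty-lookup (false ∷ b) empty (suc i) = isEmpty-lookup b empty i

isEmpty⇒≡∅ : ∀ {k} (b : Subset k) → isEmpty b ≡ true → b ≡ ∅
isEmpty⇒≡∅ []          _     = refl
isEmpty⇒≡∅ (false ∷ b) empty = cong (false ∷_) (isEmpty⇒≡∅ b empty)

nonempty-lookup : ∀ {k} (b : Subset k) → isEmpty b ≡ false → Σ (Fin k) (λ i → lookup b i ≡ true)
nonempty-lookup (true ∷ b)  _        = zero , refl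
nonempty-lookup (false ∷ b) nonempty = let (i , b∋i) = nonempty-lookup b nonempty in suc i , b∋i

SubsetFun₂ : ℕ → Set
SubsetFun₂ m = Subset m → Subset m → ℚ

tail² : ∀ {m} → Bool → Bool → SubsetFun₂ (suc m) → SubsetFun₂ m
tail² x y H b c = H (x ∷ b) (y ∷ c)

-- sumSplits H D sums H b c over the ordered pairs of disjoint b, c with b ∪ c = D
sumSplits : ∀ {m} → SubsetFun₂ m → SubsetFun m
sumSplits {zero}  H []          = H [] []
sumSplits {suc m} H (false ∷ D) = sumSplits (tail² false false H) D
sumSplits {suc m} H (true ∷ D)  = sumSplits (tail² true false H) D + sumSplits (tail² false true H) D

sumSplits-cong : ∀ {m} {H H′ : SubsetFun₂ m} → (∀ b c → H b c ≡ H′ b c) → sumSplits H ≗ sumSplits H′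
sumSplits-cong {zero}  e []          = e [] []
sumSplits-cong {suc m} e (false ∷ D) = sumSplits-cong (λ b c → e (false ∷ b) (false ∷ c)) D
sumSplits-cong {suc m} e (true ∷ D)  =
  cong₂ _+_ (sumSplits-cong (λ b c → e (true ∷ b) (false ∷ c)) D)
            (sumSplits-cong (λ b c → e (false ∷ b) (true ∷ c)) D)

sumSplits-+ : ∀ {m} (H H′ : SubsetFun₂ m) D →
              sumSplits (λ b c → H b c + H′ b c) D ≡ sumSplits H D + sumSplits H′ D
sumSplits-+ {zero}  H H′ []          = refl
sumSplits-+ {suc m} H H′ (false ∷ D) = sumSplits-+ (tail² false false H) (tail² false false H′) D
sumSplits-+ {suc m} H H′ (true ∷ D)  =
  trans (cong₂ _+_ (sumSplits-+ (tail² true false H) (tail² true false H′) D)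
                   (sumSplits-+ (tail² false true H) (tail² false true H′) D))
        (+-Props.interchange (sumSplits (tail² true false H) D) (sumSplits (tail² true false H′) D)
                             (sumSplits (tail² false true H) D) (sumSplits (tail² false true H′) D))

sumSplits-*ˡ : ∀ {m} k (H : SubsetFun₂ m) D → sumSplits (λ b c → k * H b c) D ≡ k * sumSplits H D
sumSplits-*ˡ {zero}  k H []          = refl
sumSplits-*ˡ {suc m} k H (false ∷ D) = sumSplits-*ˡ k (tail² false false H) D
sumSplits-*ˡ {suc m} k H (true ∷ D)  =
  trans (cong₂ _+_ (sumSplits-*ˡ k (tail² true false H) D) (sumSplits-*ˡ k (tail² false true H) D))
        (sym (*-distribˡ-+ k (sumSplits (tail² true false H) D) (sumSplits (tail² false true H) D)))

sumSplits-zero : ∀ {m} → sumSplits {m} (λ _ _ → 0ℚ) ≗ λ _ → 0ℚ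
sumSplits-zero {zero}  []          = refl
sumSplits-zero {suc m} (false ∷ D) = sumSplits-zero D
sumSplits-zero {suc m} (true ∷ D)  = cong₂ _+_ (sumSplits-zero D) (sumSplits-zero D)

sumSplits-swap : ∀ {m} (H : SubsetFun₂ m) → sumSplits (λ b c → H c b) ≗ sumSplits H
sumSplits-swap {zero}  H []          = refl
sumSplits-swap {suc m} H (false ∷ D) = sumSplits-swap (tail² false false H) D
sumSplits-swap {suc m} H (true ∷ D)  =
  trans (cong₂ _+_ (sumSplits-swap (tail² false true H) D) (sumSplits-swap (tail² true false H) D))
        (+-comm (sumSplits (tail² false true H) D) (sumSplits (tail² true false H) D))

sumSplits-weight : ∀ {m} (φ : ℕ → ℚ) (H : SubsetFun₂ m) D →
                   sumSplits (λ b c → φ (∣ b ∣ ℕ.+ ∣ c ∣) * H b c) D ≡ φ ∣ D ∣ * sumSplits H D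
sumSplits-weight {zero}  φ H []          = refl
sumSplits-weight {suc m} φ H (false ∷ D) = sumSplits-weight φ (tail² false false H) D
sumSplits-weight {suc m} φ H (true ∷ D)  =
  trans (cong₂ _+_ (sumSplits-weight (φ ∘ suc) (tail² true false H) D)
                   (trans (sumSplits-cong (λ b c → cong (λ k → φ k * H (false ∷ b) (true ∷ c))
                                                        (ℕ.+-suc ∣ b ∣ ∣ c ∣)) D)
                          (sumSplits-weight (φ ∘ suc) (tail² false true H) D)))
        (sym (*-distribˡ-+ (φ (suc ∣ D ∣)) (sumSplits (tail² true false H) D) (sumSplits (tail² false true H) D)))

infixl 7 _⋆_

_⋆_ : ∀ {m} → SubsetFun m → SubsetFun m → SubsetFun m
f ⋆ g = sumSplits (λ b c → f b * g c)

⋆-cong : ∀ {m} {f f′ g g′ : SubsetFun m} → f ≗ f′ → g ≗ g′ → f ⋆ g ≗ f′ ⋆ g′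
⋆-cong f≗f′ g≗g′ = sumSplits-cong (λ b c → cong₂ _*_ (f≗f′ b) (g≗g′ c))

⋆-congˡ : ∀ {m} (f : SubsetFun m) {g g′ : SubsetFun m} → g ≗ g′ → f ⋆ g ≗ f ⋆ g′
⋆-congˡ f = ⋆-cong {f = f} (λ _ → refl)

⋆-comm : ∀ {m} (f g : SubsetFun m) → f ⋆ g ≗ g ⋆ f
⋆-comm f g D = trans (sumSplits-cong (λ b c → *-comm (f b) (g c)) D) (sumSplits-swap _ D)

⋆-zeroʳ : ∀ {m} (f : SubsetFun m) → f ⋆ (λ _ → 0ℚ) ≗ λ _ → 0ℚ
⋆-zeroʳ f D = trans (sumSplits-cong (λ b _ → *-zeroʳ (f b)) D) (sumSplits-zero D)

⋆-distribˡ-+ : ∀ {m} (f g h : SubsetFun m) → f ⋆ (λ c → g c + h c) ≗ λ D → (f ⋆ g) D + (f ⋆ h) D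
⋆-distribˡ-+ f g h D = trans (sumSplits-cong (λ b c → *-distribˡ-+ (f b) (g c) (h c)) D) (sumSplits-+ _ _ D)

⋆-distribʳ-+ : ∀ {m} (f g h : SubsetFun m) → (λ b → f b + g b) ⋆ h ≗ λ D → (f ⋆ h) D + (g ⋆ h) D
⋆-distribʳ-+ f g h D = trans (sumSplits-cong (λ b c → *-distribʳ-+ (h c) (f b) (g b)) D) (sumSplits-+ _ _ D)

*-⋆ : ∀ {m} k (f g : SubsetFun m) → (λ b → k * f b) ⋆ g ≗ λ D → k * (f ⋆ g) D
*-⋆ k f g D = trans (sumSplits-cong (λ b c → *-assoc k (f b) (g c)) D) (sumSplits-*ˡ k _ D)

⋆-* : ∀ {m} k (f g : SubsetFun m) → f ⋆ (λ c → k * g c) ≗ λ D → k * (f ⋆ g) D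
⋆-* k f g D = trans (sumSplits-cong (λ b c → *-Props.x∙yz≈y∙xz (f b) k (g c)) D) (sumSplits-*ˡ k _ D)

δ-⋆ : ∀ {m} (g : SubsetFun m) → δ ⋆ g ≗ g
δ-⋆ {zero}  g []          = *-identityˡ (g [])
δ-⋆ {suc m} g (false ∷ D) = δ-⋆ (g ∘ (false ∷_)) D
δ-⋆ {suc m} g (true ∷ D)  =
  trans (cong₂ _+_ (trans (sumSplits-cong (λ _ c → *-zeroˡ (g (false ∷ c))) D) (sumSplits-zero D))
                   (δ-⋆ (g ∘ (true ∷_)) D))
        (+-identityˡ _)

⋆-assoc : ∀ {m} (f g h : SubsetFun m) → (f ⋆ g) ⋆ h ≗ f ⋆ (g ⋆ h)
⋆-assoc {zero}  f g h []          = *-assoc (f []) (g []) (h [])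
⋆-assoc {suc m} f g h (false ∷ D) = ⋆-assoc (f ∘ (false ∷_)) (g ∘ (false ∷_)) (h ∘ (false ∷_)) D
⋆-assoc {suc m} f g h (true ∷ D)  = begin
    ((λ b → (fT ⋆ gF) b + (fF ⋆ gT) b) ⋆ hF) D + ((fF ⋆ gF) ⋆ hT) D
  ≡⟨ cong (_+ ((fF ⋆ gF) ⋆ hT) D) (⋆-distribʳ-+ (fT ⋆ gF) (fF ⋆ gT) hF D) ⟩
    ((fT ⋆ gF) ⋆ hF) D + ((fF ⋆ gT) ⋆ hF) D + ((fF ⋆ gF) ⋆ hT) D
  ≡⟨ cong₂ _+_ (cong₂ _+_ (⋆-assoc fT gF hF D) (⋆-assoc fF gT hF D)) (⋆-assoc fF gF hT D) ⟩
    (fT ⋆ (gF ⋆ hF)) D + (fF ⋆ (gT ⋆ hF)) D + (fF ⋆ (gF ⋆ hT)) D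
  ≡⟨ +-assoc ((fT ⋆ (gF ⋆ hF)) D) ((fF ⋆ (gT ⋆ hF)) D) ((fF ⋆ (gF ⋆ hT)) D) ⟩
    (fT ⋆ (gF ⋆ hF)) D + ((fF ⋆ (gT ⋆ hF)) D + (fF ⋆ (gF ⋆ hT)) D)
  ≡⟨ cong ((fT ⋆ (gF ⋆ hF)) D +_) (⋆-distribˡ-+ fF (gT ⋆ hF) (gF ⋆ hT) D) ⟨
    (fT ⋆ (gF ⋆ hF)) D + (fF ⋆ (λ c → (gT ⋆ hF) c + (gF ⋆ hT) c)) D
  ∎
  where
  open ≡-Reasoning
  fT fF gT gF hT hF : SubsetFun m
  fT = f ∘ (true ∷_) ; fF = f ∘ (false ∷_)
  gT = g ∘ (true ∷_) ; gF = g ∘ (false ∷_)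
  hT = h ∘ (true ∷_) ; hF = h ∘ (false ∷_)

euler : ∀ {m} → SubsetFun m → SubsetFun m
euler f D = fromℕ ∣ D ∣ * f D

euler-⋆ : ∀ {m} (f g : SubsetFun m) → euler (f ⋆ g) ≗ λ D → (euler f ⋆ g) D + (f ⋆ euler g) D
euler-⋆ f g D = begin
    fromℕ ∣ D ∣ * (f ⋆ g) D
  ≡⟨ sumSplits-weight fromℕ _ D ⟨
    sumSplits (λ b c → fromℕ (∣ b ∣ ℕ.+ ∣ c ∣) * (f b * g c)) D
  ≡⟨ sumSplits-cong (λ b c → product-rule (∣ b ∣) (∣ c ∣) (f b) (g c)) D ⟩
    sumSplits (λ b c → euler f b * g c + f b * euler g c) D
  ≡⟨ sumSplits-+ _ _ D ⟩
    (euler f ⋆ g) D + (f ⋆ euler g) D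
  ∎
  where
  open ≡-Reasoning
  product-rule : ∀ k l x y → fromℕ (k ℕ.+ l) * (x * y) ≡ fromℕ k * x * y + x * (fromℕ l * y)
  product-rule k l x y =
    trans (cong (_* (x * y)) (fromℕ-+ k l))
          (solve 4 (λ p q x y → (p :+ q) :* (x :* y) := p :* x :* y :+ x :* (q :* y)) refl
                 (fromℕ k) (fromℕ l) x y)

-- Linear factors and Newton's identity

monomial : ∀ {m} → (Fin m → ℚ) → SubsetFun m
monomial {zero}  x []          = 1ℚ
monomial {suc m} x (false ∷ D) = monomial (x ∘ suc) D
monomial {suc m} x (true ∷ D)  = x zero * monomial (x ∘ suc) D

monomial-∅ : ∀ {m} (x : Fin m → ℚ) D → ∣ D ∣ ≡ 0 → monomial x D ≡ 1ℚ
monomial-∅ {zero}  x []          _   = refl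
monomial-∅ {suc m} x (false ∷ D) ∣D∣≡0 = monomial-∅ (x ∘ suc) D ∣D∣≡0

radial : ∀ {m} → (ℕ → ℚ) → (Fin m → ℚ) → SubsetFun m
radial φ x D = φ ∣ D ∣ * monomial x D

linearCoeff : ℕ → ℚ
linearCoeff zero          = 1ℚ
linearCoeff (suc zero)    = 1ℚ
linearCoeff (suc (suc _)) = 0ℚ

linear : ∀ {m} → (Fin m → ℚ) → SubsetFun m
linear = radial linearCoeff

linear-∷ : ∀ {m} (x : Fin (suc m) → ℚ) D → linear x (true ∷ D) ≡ x zero * δ D
linear-∷ x D with ∣ D ∣ in ∣D∣≡k
... | zero  = trans (*-identityˡ _) (cong (x zero *_) (monomial-∅ (x ∘ suc) D ∣D∣≡k))
... | suc _ = trans (*-zeroˡ (x zero * monomial (x ∘ suc) D)) (sym (*-zeroʳ (x zero)))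

linear⋆ : (ℕ → ℚ) → ℕ → ℚ
linear⋆ φ zero    = φ zero
linear⋆ φ (suc k) = φ (suc k) + fromℕ (suc k) * φ k

linear⋆-suc : ∀ φ k → linear⋆ φ (suc k) ≡ φ k + linear⋆ (φ ∘ suc) k
linear⋆-suc φ zero    = trans (cong (λ t → φ 1 + t * φ 0) (+-identityʳ 1ℚ))
                              (solve 2 (λ a b → b :+ con 1ℚ :* a := a :+ b) refl (φ 0) (φ 1))
linear⋆-suc φ (suc k) = solve 3 (λ a b n → b :+ (con 1ℚ :+ n) :* a := a :+ (b :+ n :* a)) refl
                              (φ (suc k)) (φ (suc (suc k))) (fromℕ (suc k))

linear-⋆-radial : ∀ {m} φ (x : Fin m → ℚ) → linear x ⋆ radial φ x ≗ radial (linear⋆ φ) x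
linear-⋆-radial {zero}  φ x [] =
  solve 1 (λ a → (con 1ℚ :* con 1ℚ) :* (a :* con 1ℚ) := a :* con 1ℚ) refl (φ 0)
linear-⋆-radial {suc m} φ x (false ∷ D) = linear-⋆-radial φ (x ∘ suc) D
linear-⋆-radial {suc m} φ x (true ∷ D)  = begin
    (linear x ∘ (true ∷_) ⋆ radial φ x ∘ (false ∷_)) D + (linear x′ ⋆ radial φ x ∘ (true ∷_)) D
  ≡⟨ cong₂ _+_ (⋆-cong (linear-∷ x) (λ _ → refl) D)
               (⋆-congˡ (linear x′) (λ c → *-Props.x∙yz≈y∙xz (φ (suc ∣ c ∣)) x₀ (monomial x′ c)) D) ⟩
    ((λ b → x₀ * δ b) ⋆ radial φ x′) D + (linear x′ ⋆ (λ c → x₀ * radial (φ ∘ suc) x′ c)) D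
  ≡⟨ cong₂ _+_ (trans (*-⋆ x₀ δ (radial φ x′) D) (cong (x₀ *_) (δ-⋆ (radial φ x′) D)))
               (trans (⋆-* x₀ (linear x′) (radial (φ ∘ suc) x′) D)
                      (cong (x₀ *_) (linear-⋆-radial (φ ∘ suc) x′ D))) ⟩
    x₀ * (φ ∣ D ∣ * monomial x′ D) + x₀ * (linear⋆ (φ ∘ suc) ∣ D ∣ * monomial x′ D)
  ≡⟨ solve 4 (λ x₀ a b u → x₀ :* (a :* u) :+ x₀ :* (b :* u) := (a :+ b) :* (x₀ :* u)) refl
           x₀ (φ ∣ D ∣) (linear⋆ (φ ∘ suc) ∣ D ∣) (monomial x′ D) ⟩
    (φ ∣ D ∣ + linear⋆ (φ ∘ suc) ∣ D ∣) * (x₀ * monomial x′ D)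
  ≡⟨ cong (_* (x₀ * monomial x′ D)) (linear⋆-suc φ ∣ D ∣) ⟨
    radial (linear⋆ φ) x (true ∷ D)
  ∎
  where
  open ≡-Reasoning
  x₀ = x zero
  x′ = x ∘ suc

-- logCoeff k = (-1)^(k-1) k! for k ≥ 1, the solution of linear⋆ logCoeff k = k * linearCoeff k
logCoeff : ℕ → ℚ
logCoeff zero          = 0ℚ
logCoeff (suc zero)    = 1ℚ
logCoeff (suc (suc k)) = - (fromℕ (suc (suc k)) * logCoeff (suc k))

euler-linear : ∀ {m} (x : Fin m → ℚ) → euler (linear x) ≗ linear x ⋆ radial logCoeff x
euler-linear x D = begin
    fromℕ ∣ D ∣ * (linearCoeff ∣ D ∣ * monomial x D)
  ≡⟨ *-assoc (fromℕ ∣ D ∣) (linearCoeff ∣ D ∣) (monomial x D) ⟨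
    fromℕ ∣ D ∣ * linearCoeff ∣ D ∣ * monomial x D
  ≡⟨ cong (_* monomial x D) (linear⋆-logCoeff ∣ D ∣) ⟩
    radial (linear⋆ logCoeff) x D
  ≡⟨ linear-⋆-radial logCoeff x D ⟨
    (linear x ⋆ radial logCoeff x) D
  ∎
  where
  open ≡-Reasoning
  linear⋆-logCoeff : ∀ k → fromℕ k * linearCoeff k ≡ linear⋆ logCoeff k
  linear⋆-logCoeff zero          = *-zeroˡ 1ℚ
  linear⋆-logCoeff (suc zero)    = solve 0 ((con 1ℚ :+ con 0ℚ) :* con 1ℚ := con 1ℚ :+ (con 1ℚ :+ con 0ℚ) :* con 0ℚ) refl
  linear⋆-logCoeff (suc (suc k)) =
    trans (*-zeroʳ (fromℕ (suc (suc k)))) (solve 2 (λ n e → con 0ℚ := :- (n :* e) :+ n :* e) refl (fromℕ (suc (suc k))) (logCoeff (suc k)))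

sumOver : ∀ {A : Set} → List A → (A → ℚ) → ℚ
sumOver xs f = List.foldr (λ x r → f x + r) 0ℚ xs

sumOver-cong : ∀ {A : Set} {P : A → Set} xs {f g : A → ℚ} → All P xs → (∀ x → P x → f x ≡ g x) →
               sumOver xs f ≡ sumOver xs g
sumOver-cong []       []         e = refl
sumOver-cong (x ∷ xs) (px ∷ pxs) e = cong₂ _+_ (e x px) (sumOver-cong xs pxs e)

sumOver-cong′ : ∀ {A : Set} xs {f g : A → ℚ} → f ≗ g → sumOver xs f ≡ sumOver xs g
sumOver-cong′ []       e = refl
sumOver-cong′ (x ∷ xs) e = cong₂ _+_ (e x) (sumOver-cong′ xs e)

sumOver-*ˡ : ∀ {A : Set} xs k (f : A → ℚ) → sumOver xs (λ x → k * f x) ≡ k * sumOver xs f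
sumOver-*ˡ []       k f = sym (*-zeroʳ k)
sumOver-*ˡ (x ∷ xs) k f = trans (cong (k * f x +_) (sumOver-*ˡ xs k f)) (sym (*-distribˡ-+ k (f x) (sumOver xs f)))

⋆-sumOver : ∀ {m} {A : Set} xs (f : SubsetFun m) (G : A → SubsetFun m) →
            f ⋆ (λ c → sumOver xs (λ x → G x c)) ≗ λ D → sumOver xs (λ x → (f ⋆ G x) D)
⋆-sumOver []       f G D = ⋆-zeroʳ f D
⋆-sumOver (x ∷ xs) f G D =
  trans (⋆-distribˡ-+ f (G x) (λ c → sumOver xs (λ x → G x c)) D)
        (cong ((f ⋆ G x) D +_) (⋆-sumOver xs f G D))

linear-⋆-∷ : ∀ {m} (x : Fin (suc m) → ℚ) (g : SubsetFun (suc m)) D →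
             (linear x ⋆ g) (true ∷ D) ≡ x zero * g (false ∷ D) + (linear (x ∘ suc) ⋆ g ∘ (true ∷_)) D
linear-⋆-∷ x g D = cong (_+ (linear (x ∘ suc) ⋆ g ∘ (true ∷_)) D)
  (trans (⋆-cong (linear-∷ x) (λ _ → refl) D)
         (trans (*-⋆ (x zero) δ (g ∘ (false ∷_)) D) (cong (x zero *_) (δ-⋆ (g ∘ (false ∷_)) D))))

module Columns {n : ℕ} where

  column : ∀ {m} → (Fin m → Fin n → ℚ) → Fin n → Fin m → ℚ
  column a j i = a i j

  -- columns marked in used are skipped, as in the recursion of injSum
  columnProduct : ∀ {m} → (Fin m → Fin n → ℚ) → Vec Bool n → List (Fin n) → SubsetFun m
  columnProduct a used []       = δ
  columnProduct a used (j ∷ cs) =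
    if lookup used j then columnProduct a used cs else linear (column a j) ⋆ columnProduct a used cs

  columnProduct-[] : (a : Fin 0 → Fin n → ℚ) → ∀ used cs → columnProduct a used cs [] ≡ 1ℚ
  columnProduct-[] a used []       = refl
  columnProduct-[] a used (j ∷ cs) with lookup used j
  ... | true  = columnProduct-[] a used cs
  ... | false = trans (*-identityˡ _) (columnProduct-[] a used cs)

  columnProduct-false∷ : ∀ {m} (a : Fin (suc m) → Fin n → ℚ) used cs D →
                         columnProduct a used cs (false ∷ D) ≡ columnProduct (a ∘ suc) used cs D
  columnProduct-false∷ a used []       D = refl
  columnProduct-false∷ a used (j ∷ cs) D with lookup used j
  ... | true  = columnProduct-false∷ a used cs D
  ... | false = ⋆-congˡ (linear (column (a ∘ suc) j)) (columnProduct-false∷ a used cs) D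

  columnProduct-mark : ∀ {m} (a : Fin m → Fin n → ℚ) used {k} cs → All (k ≢_) cs →
                       columnProduct a (used [ k ]≔ true) cs ≡ columnProduct a used cs
  columnProduct-mark a used []       []            = refl
  columnProduct-mark a used {k} (j ∷ cs) (k≢j ∷ k∉cs) =
    cong₂ (λ u p → if u then p else linear (column a j) ⋆ p)
          (lookup∘update′ (k≢j ∘ sym) used true) (columnProduct-mark a used cs k∉cs)

  rowTerm : ∀ {m} → (Fin (suc m) → Fin n → ℚ) → Vec Bool n → List (Fin n) → Fin n → SubsetFun m
  rowTerm a used cs k D = if lookup used k then 0ℚ else a zero k * columnProduct (a ∘ suc) (used [ k ]≔ true) cs D

  columnProduct-∷-marked : ∀ {m} (a : Fin m → Fin n → ℚ) {used j} cs → lookup used j ≡ true →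
                           columnProduct a used (j ∷ cs) ≡ columnProduct a used cs
  columnProduct-∷-marked a {used} {j} cs marked =
    cong (λ u → if u then columnProduct a used cs else linear (column a j) ⋆ columnProduct a used cs) marked

  columnProduct-∷-unmarked : ∀ {m} (a : Fin m → Fin n → ℚ) {used j} cs → lookup used j ≡ false →
                             columnProduct a used (j ∷ cs) ≡ linear (column a j) ⋆ columnProduct a used cs
  columnProduct-∷-unmarked a {used} {j} cs unmarked =
    cong (λ u → if u then columnProduct a used cs else linear (column a j) ⋆ columnProduct a used cs) unmarked

  rowTerm-∷-marked : ∀ {m} (a : Fin (suc m) → Fin n → ℚ) used {j} cs → lookup used j ≡ true →
                     ∀ k → j ≢ k → ∀ D → rowTerm a used cs k D ≡ rowTerm a used (j ∷ cs) k D
  rowTerm-∷-marked a used {j} cs marked k j≢k D =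
    cong (λ p → if lookup used k then 0ℚ else a zero k * p D)
         (sym (columnProduct-∷-marked (a ∘ suc) cs (trans (lookup∘update′ j≢k used true) marked)))

  rowTerm-∷-unmarked : ∀ {m} (a : Fin (suc m) → Fin n → ℚ) used {j} cs → lookup used j ≡ false →
                       ∀ k → j ≢ k → ∀ D →
                       (linear (column (a ∘ suc) j) ⋆ rowTerm a used cs k) D ≡ rowTerm a used (j ∷ cs) k D
  rowTerm-∷-unmarked a used {j} cs unmarked k j≢k D with lookup used k
  ... | true  = ⋆-zeroʳ (linear (column (a ∘ suc) j)) D
  ... | false =
    trans (⋆-* (a zero k) (linear (column (a ∘ suc) j)) (columnProduct (a ∘ suc) (used [ k ]≔ true) cs) D)
          (cong (λ p → a zero k * p D)
                (sym (columnProduct-∷-unmarked (a ∘ suc) cs (trans (lookup∘update′ j≢k used true) unmarked))))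

  columnProduct-true∷ : ∀ {m} (a : Fin (suc m) → Fin n → ℚ) used cs → Unique cs → ∀ D →
                        columnProduct a used cs (true ∷ D) ≡ sumOver cs (λ k → rowTerm a used cs k D)
  columnProduct-true∷ a used []       []          D = refl
  columnProduct-true∷ a used (j ∷ cs) (j∉cs ∷ u) D with lookup used j in used-j
  ... | true  = trans (columnProduct-true∷ a used cs u D)
                      (trans (sumOver-cong cs j∉cs (λ k j≢k → rowTerm-∷-marked a used cs used-j k j≢k D))
                             (sym (+-identityˡ _)))
  ... | false = begin
      (linear (column a j) ⋆ P) (true ∷ D)
    ≡⟨ linear-⋆-∷ (column a j) P D ⟩
      a zero j * P (false ∷ D) + (L′ ⋆ P ∘ (true ∷_)) D
    ≡⟨ cong₂ _+_ (cong (a zero j *_) (columnProduct-false∷ a used cs D))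
                 (⋆-congˡ L′ (columnProduct-true∷ a used cs u) D) ⟩
      a zero j * columnProduct (a ∘ suc) used cs D + (L′ ⋆ (λ c → sumOver cs (λ k → rowTerm a used cs k c))) D
    ≡⟨ cong₂ _+_ (cong (a zero j *_) first) (⋆-sumOver cs L′ (rowTerm a used cs) D) ⟩
      a zero j * columnProduct (a ∘ suc) (used [ j ]≔ true) (j ∷ cs) D + sumOver cs (λ k → (L′ ⋆ rowTerm a used cs k) D)
    ≡⟨ cong (a zero j * columnProduct (a ∘ suc) (used [ j ]≔ true) (j ∷ cs) D +_)
            (sumOver-cong cs j∉cs (λ k j≢k → rowTerm-∷-unmarked a used cs used-j k j≢k D)) ⟩
      a zero j * columnProduct (a ∘ suc) (used [ j ]≔ true) (j ∷ cs) D + sumOver cs (λ k → rowTerm a used (j ∷ cs) k D)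
    ∎
    where
    open ≡-Reasoning
    P = columnProduct a used cs
    L′ = linear (column (a ∘ suc) j)
    first : columnProduct (a ∘ suc) used cs D ≡ columnProduct (a ∘ suc) (used [ j ]≔ true) (j ∷ cs) D
    first = sym (cong (_$ D) (trans (columnProduct-∷-marked (a ∘ suc) cs (lookup∘update j used true))
                                    (columnProduct-mark (a ∘ suc) used cs j∉cs)))

  euler-δ : ∀ {m} → euler (δ {m}) ≗ λ _ → 0ℚ
  euler-δ D with ∣ D ∣
  ... | zero  = *-zeroˡ 1ℚ
  ... | suc k = *-zeroʳ (fromℕ (suc k))

  logColumns : ∀ {m} → (Fin m → Fin n → ℚ) → Vec Bool n → List (Fin n) → SubsetFun m
  logColumns a used cs D = sumOver cs (λ k → if lookup used k then 0ℚ else radial logCoeff (column a k) D)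

  euler-columnProduct : ∀ {m} (a : Fin m → Fin n → ℚ) used cs →
                        euler (columnProduct a used cs) ≗ columnProduct a used cs ⋆ logColumns a used cs
  euler-columnProduct a used []       D = trans (euler-δ D) (sym (δ-⋆ (λ _ → 0ℚ) D))
  euler-columnProduct a used (j ∷ cs) D with lookup used j
  ... | true  = trans (euler-columnProduct a used cs D)
                      (⋆-congˡ (columnProduct a used cs) (λ c → sym (+-identityˡ _)) D)
  ... | false = begin
      euler (L ⋆ P) D
    ≡⟨ euler-⋆ L P D ⟩
      (euler L ⋆ P) D + (L ⋆ euler P) D
    ≡⟨ cong₂ _+_ (⋆-cong (euler-linear (column a j)) (λ _ → refl) D)
                 (⋆-congˡ L (euler-columnProduct a used cs) D) ⟩
      ((L ⋆ ℓ) ⋆ P) D + (L ⋆ (P ⋆ ℓs)) D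
    ≡⟨ cong₂ _+_ (trans (⋆-assoc L ℓ P D) (trans (⋆-congˡ L (⋆-comm ℓ P) D) (sym (⋆-assoc L P ℓ D))))
                 (sym (⋆-assoc L P ℓs D)) ⟩
      ((L ⋆ P) ⋆ ℓ) D + ((L ⋆ P) ⋆ ℓs) D
    ≡⟨ ⋆-distribˡ-+ (L ⋆ P) ℓ ℓs D ⟨
      ((L ⋆ P) ⋆ (λ c → ℓ c + ℓs c)) D
    ∎
    where
    open ≡-Reasoning
    L = linear (column a j)
    P = columnProduct a used cs
    ℓ = radial logCoeff (column a j)
    ℓs = logColumns a used cs

filter-tabulate-suc : ∀ {m k} x (D : Subset m) (f : Fin k → Fin m) →
                      filter (T? ∘ lookup (x ∷ D)) (tabulate (suc ∘ f)) ≡ List.map suc (filter (T? ∘ lookup D) (tabulate f))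
filter-tabulate-suc {k = zero}  x D f = refl
filter-tabulate-suc {k = suc k} x D f with lookup D (f zero)
... | true  = cong (suc (f zero) ∷_) (filter-tabulate-suc x D (f ∘ suc))
... | false = filter-tabulate-suc x D (f ∘ suc)

elems-false∷ : ∀ {m} (D : Subset m) → elems (false ∷ D) ≡ List.map suc (elems D)
elems-false∷ D = filter-tabulate-suc false D id

elems-true∷ : ∀ {m} (D : Subset m) → elems (true ∷ D) ≡ zero ∷ List.map suc (elems D)
elems-true∷ D = cong (zero ∷_) (filter-tabulate-suc true D id)

elems-∅ : ∀ m → elems (∅ {m}) ≡ []
elems-∅ zero    = refl
elems-∅ (suc m) = trans (elems-false∷ ∅) (cong (List.map suc) (elems-∅ m))

module InjectiveSums {n : ℕ} where
  open Columns {n}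

  injSum-map-suc : ∀ {m} (a : Fin (suc m) → Fin n → ℚ) is used →
                   injSum a (List.map suc is) used ≡ injSum (a ∘ suc) is used
  injSum-map-suc a []       used = refl
  injSum-map-suc a (i ∷ is) used =
    sumOver-cong′ (allFin n) (λ j → cong (λ t → if lookup used j then 0ℚ else a (suc i) j * t)
                                        (injSum-map-suc a is (used [ j ]≔ true)))

  injSum-columnProduct : ∀ {m} (a : Fin m → Fin n → ℚ) D used →
                         injSum a (elems D) used ≡ columnProduct a used (allFin n) D
  injSum-columnProduct {zero}  a []          used = sym (columnProduct-[] a used (allFin n))
  injSum-columnProduct {suc m} a (false ∷ D) used = begin
      injSum a (elems (false ∷ D)) used
    ≡⟨ cong (λ is → injSum a is used) (elems-false∷ D) ⟩
      injSum a (List.map suc (elems D)) used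
    ≡⟨ injSum-map-suc a (elems D) used ⟩
      injSum (a ∘ suc) (elems D) used
    ≡⟨ injSum-columnProduct (a ∘ suc) D used ⟩
      columnProduct (a ∘ suc) used (allFin n) D
    ≡⟨ columnProduct-false∷ a used (allFin n) D ⟨
      columnProduct a used (allFin n) (false ∷ D)
    ∎
    where open ≡-Reasoning
  injSum-columnProduct {suc m} a (true ∷ D)  used = begin
      injSum a (elems (true ∷ D)) used
    ≡⟨ cong (λ is → injSum a is used) (elems-true∷ D) ⟩
      injSum a (zero ∷ List.map suc (elems D)) used
    ≡⟨ sumOver-cong′ (allFin n) (λ j → cong (λ t → if lookup used j then 0ℚ else a zero j * t)
                                           (trans (injSum-map-suc a (elems D) (used [ j ]≔ true))
                                                  (injSum-columnProduct (a ∘ suc) D (used [ j ]≔ true)))) ⟩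
      sumOver (allFin n) (λ k → rowTerm a used (allFin n) k D)
    ≡⟨ columnProduct-true∷ a used (allFin n) (allFin⁺ n) D ⟨
      columnProduct a used (allFin n) (true ∷ D)
    ∎
    where open ≡-Reasoning

module Newton {n : ℕ} where
  open Columns {n}
  open InjectiveSums {n}

  injectiveSum : ∀ {m} → (Fin m → Fin n → ℚ) → SubsetFun m
  injectiveSum a D = injSum a (elems D) ∅

  powerSum : ∀ {m} → (Fin m → Fin n → ℚ) → SubsetFun m
  powerSum a b = sumOver (allFin n) (λ j → monomial (column a j) b)

  logSum : ∀ {m} → (Fin m → Fin n → ℚ) → SubsetFun m
  logSum a b = logCoeff ∣ b ∣ * powerSum a b

  logColumns-∅ : ∀ {m} (a : Fin m → Fin n → ℚ) → logColumns a ∅ (allFin n) ≗ logSum a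
  logColumns-∅ a b =
    trans (sumOver-cong′ (allFin n) (λ k → cong (λ u → if u then 0ℚ else radial logCoeff (column a k) b)
                                                (lookup-replicate k false)))
          (sumOver-*ˡ (allFin n) (logCoeff ∣ b ∣) (λ j → monomial (column a j) b))

  euler-injectiveSum : ∀ {m} (a : Fin m → Fin n → ℚ) → euler (injectiveSum a) ≗ logSum a ⋆ injectiveSum a
  euler-injectiveSum a D = begin
      fromℕ ∣ D ∣ * injectiveSum a D
    ≡⟨ cong (fromℕ ∣ D ∣ *_) (injSum-columnProduct a D ∅) ⟩
      euler P D
    ≡⟨ euler-columnProduct a ∅ (allFin n) D ⟩
      (P ⋆ logColumns a ∅ (allFin n)) D
    ≡⟨ ⋆-comm P (logColumns a ∅ (allFin n)) D ⟩
      (logColumns a ∅ (allFin n) ⋆ P) D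
    ≡⟨ ⋆-cong (logColumns-∅ a) (λ c → sym (injSum-columnProduct a c ∅)) D ⟩
      (logSum a ⋆ injectiveSum a) D
    ∎
    where
    open ≡-Reasoning
    P = columnProduct a ∅ (allFin n)

  newton : ∀ {m} (a : Fin m → Fin n → ℚ) D →
           injectiveSum a D ≡ δ D + recip ∣ D ∣ * (logSum a ⋆ injectiveSum a) D
  newton a D with ∣ D ∣ in ∣D∣≡k
  ... | zero  = begin
      injectiveSum a D
    ≡⟨ cong (λ is → injSum a is ∅) (trans (cong elems (∣D∣≡0⇒D≡∅ D ∣D∣≡k)) (elems-∅ _)) ⟩
      1ℚ
    ≡⟨ solve 1 (λ s → con 1ℚ := con 1ℚ :+ con 0ℚ :* s) refl ((logSum a ⋆ injectiveSum a) D) ⟩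
      1ℚ + 0ℚ * (logSum a ⋆ injectiveSum a) D
    ∎
    where open ≡-Reasoning
  ... | suc k = begin
      injectiveSum a D
    ≡⟨ *-identityˡ (injectiveSum a D) ⟨
      1ℚ * injectiveSum a D
    ≡⟨ cong (_* injectiveSum a D) (recip-inverse k) ⟨
      recip (suc k) * fromℕ (suc k) * injectiveSum a D
    ≡⟨ *-assoc (recip (suc k)) (fromℕ (suc k)) (injectiveSum a D) ⟩
      recip (suc k) * (fromℕ (suc k) * injectiveSum a D)
    ≡⟨ cong (λ l → recip (suc k) * (fromℕ l * injectiveSum a D)) ∣D∣≡k ⟨
      recip (suc k) * euler (injectiveSum a) D
    ≡⟨ cong (recip (suc k) *_) (euler-injectiveSum a D) ⟩
      recip (suc k) * (logSum a ⋆ injectiveSum a) D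
    ≡⟨ +-identityˡ (recip (suc k) * (logSum a ⋆ injectiveSum a) D) ⟨
      0ℚ + recip (suc k) * (logSum a ⋆ injectiveSum a) D
    ∎
    where open ≡-Reasoning

-- Enumerations and big operators

record Enumeration (A : Set) : Set where
  field
    size          : ℕ
    index         : A → Fin size
    element       : Fin size → A
    element-index : ∀ x → element (index x) ≡ x
    index-element : ∀ i → index (element i) ≡ i

open Enumeration public

Fin-enum : ∀ k → Enumeration (Fin k)
Fin-enum k = record { size = k ; index = id ; element = id ; element-index = λ _ → refl ; index-element = λ _ → refl }

Bool-enum : Enumeration Bool
Bool-enum = record { size = 2 ; index = index′ ; element = element′
                   ; element-index = λ { false → refl ; true → refl }
                   ; index-element = λ { zero → refl ; (suc zero) → refl } }
  where
  index′ : Bool → Fin 2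
  index′ false = zero
  index′ true  = suc zero
  element′ : Fin 2 → Bool
  element′ zero       = false
  element′ (suc zero) = true

infixr 1 _⊎-enum_
infixr 2 _×-enum_

_⊎-enum_ : ∀ {A B} → Enumeration A → Enumeration B → Enumeration (A ⊎ B)
ea ⊎-enum eb = record
  { size          = size ea ℕ.+ size eb
  ; index         = [ (λ x → index ea x ↑ˡ size eb) , (λ y → size ea ↑ʳ index eb y) ]′
  ; element       = [ inj₁ ∘ element ea , inj₂ ∘ element eb ]′ ∘ splitAt (size ea)
  ; element-index = λ where
      (inj₁ x) → trans (cong [ inj₁ ∘ element ea , inj₂ ∘ element eb ]′ (splitAt-↑ˡ (size ea) (index ea x) (size eb)))
                       (cong inj₁ (element-index ea x))
      (inj₂ y) → trans (cong [ inj₁ ∘ element ea , inj₂ ∘ element eb ]′ (splitAt-↑ʳ (size ea) (size eb) (index eb y)))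
                       (cong inj₂ (element-index eb y))
  ; index-element = λ i → trans (index-join (splitAt (size ea) i)) (join-splitAt (size ea) (size eb) i)
  }
  where
  index-join : ∀ p → [ (λ x → index ea x ↑ˡ size eb) , (λ y → size ea ↑ʳ index eb y) ]′
                       ([ inj₁ ∘ element ea , inj₂ ∘ element eb ]′ p)
                     ≡ Fin.join (size ea) (size eb) p
  index-join (inj₁ i) = cong (_↑ˡ size eb) (index-element ea i)
  index-join (inj₂ j) = cong (size ea ↑ʳ_) (index-element eb j)

_×-enum_ : ∀ {A B} → Enumeration A → Enumeration B → Enumeration (A × B)
_×-enum_ {A} {B} ea eb = record
  { size          = size ea ℕ.* size eb
  ; index         = λ (x , y) → combine (index ea x) (index eb y)
  ; element       = element² ∘ remQuot (size eb)
  ; element-index = λ (x , y) → trans (cong element² (remQuot-combine (index ea x) (index eb y)))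
                                      (cong₂ _,_ (element-index ea x) (element-index eb y))
  ; index-element = λ i → trans (cong₂ combine (index-element ea _) (index-element eb _))
                                (combine-remQuot {size ea} (size eb) i)
  }
  where
  element² : Fin (size ea) × Fin (size eb) → A × B
  element² (i , j) = element ea i , element eb j

-- sums over the transported enumeration are definitionally sums over the original one
map-enum : ∀ {A B} (f : A → B) (g : B → A) → (∀ y → f (g y) ≡ y) → (∀ x → g (f x) ≡ x) →
           Enumeration A → Enumeration B
map-enum f g f∘g g∘f e = record
  { size          = size e
  ; index         = index e ∘ g
  ; element       = f ∘ element e
  ; element-index = λ y → trans (cong f (element-index e (g y))) (f∘g y)
  ; index-element = λ i → trans (cong (index e) (g∘f (element e i))) (index-element e i)
  }

Vec-enum : ∀ {A} → Enumeration A → ∀ m → Enumeration (Vec A m)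
Vec-enum e zero    = record { size = 1 ; index = λ _ → zero ; element = λ _ → []
                            ; element-index = λ { [] → refl } ; index-element = λ { zero → refl } }
Vec-enum e (suc m) = map-enum (uncurry _∷_) (λ v → Vec.head v , Vec.tail v) (λ { (_ ∷ _) → refl }) (λ _ → refl)
                              (e ×-enum Vec-enum e m)

size-Vec-enum : ∀ {A} (e : Enumeration A) k → size (Vec-enum e k) ≡ size e ^ k
size-Vec-enum e zero    = refl
size-Vec-enum e (suc k) = cong (size e ℕ.*_) (size-Vec-enum e k)

combine-monoʳ-< : ∀ {k l} (i : Fin k) {j j′ : Fin l} → j Fin.< j′ → combine i j Fin.< combine i j′
combine-monoʳ-< {l = l} i {j} {j′} j<j′ =
  subst₂ ℕ._<_ (sym (toℕ-combine i j)) (sym (toℕ-combine i j′)) (ℕ.+-monoʳ-< (l ℕ.* toℕ i) j<j′)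

index-inj₁<inj₂ : ∀ {A B} (ea : Enumeration A) (eb : Enumeration B) x y →
                  index (ea ⊎-enum eb) (inj₁ x) Fin.< index (ea ⊎-enum eb) (inj₂ y)
index-inj₁<inj₂ ea eb x y =
  subst₂ ℕ._<_ (sym (toℕ-↑ˡ (index ea x) (size eb))) (sym (toℕ-↑ʳ (size ea) (index eb y)))
         (ℕ.<-≤-trans (toℕ<n (index ea x)) (ℕ.m≤m+n (size ea) _))

index-inj₂-mono : ∀ {A B} (ea : Enumeration A) (eb : Enumeration B) y y′ →
                  index eb y Fin.< index eb y′ → index (ea ⊎-enum eb) (inj₂ y) Fin.< index (ea ⊎-enum eb) (inj₂ y′)
index-inj₂-mono ea eb y y′ y<y′ =
  subst₂ ℕ._<_ (sym (toℕ-↑ʳ (size ea) (index eb y))) (sym (toℕ-↑ʳ (size ea) (index eb y′)))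
         (ℕ.+-monoʳ-< (size ea) y<y′)

module BigOperator {A : Set} {_∙_ : A → A → A} {ε : A} (isCM : IsCommutativeMonoid _≡_ _∙_ ε) where
  open IsCommutativeMonoid isCM using (assoc; identityˡ; identityʳ; isMonoid)

  monoid : Monoid 0ℓ 0ℓ
  monoid = record { isMonoid = isMonoid }

  open import Algebra.Properties.Monoid.Sum monoid public using (sum; sum-cong-≗)

  sum-ε : ∀ {k} {f : Fin k → A} → (∀ i → f i ≡ ε) → sum f ≡ ε
  sum-ε {zero}  f≡ε = refl
  sum-ε {suc k} f≡ε = trans (cong₂ _∙_ (f≡ε zero) (sum-ε (f≡ε ∘ suc))) (identityˡ ε)

  sum-↑ : ∀ k {l} (f : Fin (k ℕ.+ l) → A) → sum f ≡ sum (f ∘ (_↑ˡ l)) ∙ sum (f ∘ (k ↑ʳ_))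
  sum-↑ zero    f = sym (identityˡ (sum f))
  sum-↑ (suc k) f = trans (cong (f zero ∙_) (sum-↑ k (f ∘ suc))) (sym (assoc _ _ _))

  sum-combine : ∀ k {l} (f : Fin (k ℕ.* l) → A) → sum f ≡ sum (λ i → sum (λ j → f (combine {k} {l} i j)))
  sum-combine zero        f = refl
  sum-combine (suc k) {l} f =
    trans (sum-↑ l f) (cong (sum (λ j → f (j ↑ˡ (k ℕ.* l))) ∙_) (sum-combine k (f ∘ (l ↑ʳ_))))

  foldr-tabulate : ∀ {B : Set} {k} (f : B → A) (g : Fin k → B) →
                   List.foldr (λ h r → f h ∙ r) ε (tabulate g) ≡ sum (f ∘ g)
  foldr-tabulate {k = zero}  f g = refl
  foldr-tabulate {k = suc k} f g = cong (f (g zero) ∙_) (foldr-tabulate f (g ∘ suc))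

  sum-δ : ∀ {k} (j : Fin k) (f : Fin k → A) → sum (λ i → if does (i Fin.≟ j) then f i else ε) ≡ f j
  sum-δ {suc k} zero    f = trans (cong (f zero ∙_) (sum-ε {k} (λ _ → refl))) (identityʳ (f zero))
  sum-δ {suc k} (suc j) f = trans (identityˡ _) (sum-δ j (f ∘ suc))

  sum-if : ∀ {k} c (f : Fin k → A) → sum (λ i → if c then f i else ε) ≡ (if c then sum f else ε)
  sum-if true  f = refl
  sum-if {k} false f = sum-ε {k} (λ _ → refl)

  ∑⟨_⟩ : ∀ {T} → Enumeration T → (T → A) → A
  ∑⟨ e ⟩ f = sum (f ∘ element e)

  ∑-cong : ∀ {T} (e : Enumeration T) {f g : T → A} → f ≗ g → ∑⟨ e ⟩ f ≡ ∑⟨ e ⟩ g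
  ∑-cong e f≗g = sum-cong-≗ (f≗g ∘ element e)

  ∑-ε : ∀ {T} (e : Enumeration T) {f : T → A} → (∀ x → f x ≡ ε) → ∑⟨ e ⟩ f ≡ ε
  ∑-ε e f≡ε = sum-ε (f≡ε ∘ element e)

  ∑-⊎ : ∀ {S T} (ea : Enumeration S) (eb : Enumeration T) (f : S ⊎ T → A) →
        ∑⟨ ea ⊎-enum eb ⟩ f ≡ ∑⟨ ea ⟩ (f ∘ inj₁) ∙ ∑⟨ eb ⟩ (f ∘ inj₂)
  ∑-⊎ ea eb f = trans (sum-↑ (size ea) _)
    (cong₂ _∙_ (sum-cong-≗ (λ i → cong (f ∘ [ inj₁ ∘ element ea , inj₂ ∘ element eb ]′) (splitAt-↑ˡ (size ea) i (size eb))))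
               (sum-cong-≗ (λ j → cong (f ∘ [ inj₁ ∘ element ea , inj₂ ∘ element eb ]′) (splitAt-↑ʳ (size ea) (size eb) j))))

  ∑-× : ∀ {S T} (ea : Enumeration S) (eb : Enumeration T) (f : S × T → A) →
        ∑⟨ ea ×-enum eb ⟩ f ≡ ∑⟨ ea ⟩ (λ x → ∑⟨ eb ⟩ (λ y → f (x , y)))
  ∑-× ea eb f = trans (sum-combine (size ea) _)
    (sum-cong-≗ (λ i → sum-cong-≗ (λ j →
      cong (λ (i′ , j′) → f (element ea i′ , element eb j′)) (remQuot-combine i j))))

  ∑-δ : ∀ {T} (e : Enumeration T) (_≟_ : DecidableEquality T) x (f : T → A) →
        ∑⟨ e ⟩ (λ y → if does (y ≟ x) then f y else ε) ≡ f x
  ∑-δ e _≟_ x f = begin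
      sum (λ i → if does (element e i ≟ x) then f (element e i) else ε)
    ≡⟨ sum-cong-≗ (λ i → cong (λ t → if t then f (element e i) else ε) (does-⇔ (element≡⇔≡index i) (element e i ≟ x) (i Fin.≟ index e x))) ⟩
      sum (λ i → if does (i Fin.≟ index e x) then f (element e i) else ε)
    ≡⟨ sum-δ (index e x) (f ∘ element e) ⟩
      f (element e (index e x))
    ≡⟨ cong f (element-index e x) ⟩
      f x
    ∎
    where
    open ≡-Reasoning
    element≡⇔≡index : ∀ i → (element e i ≡ x) ⇔ (i ≡ index e x)
    element≡⇔≡index i = mk⇔ (λ eq → trans (sym (index-element e i)) (cong (index e) eq))
                            (λ eq → trans (cong (element e) eq) (element-index e x))

module ℕ+ = Algebra.Properties.CommutativeMonoid.Sum ℕ.+-0-commutativeMonoid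
module ∑+ = BigOperator +-0-isCommutativeMonoid
module ∏* = BigOperator *-1-isCommutativeMonoid

∏-monomial : ∀ {k} (x : Fin k → ℚ) (b : Subset k) → ∏*.sum (λ i → if lookup b i then x i else 1ℚ) ≡ monomial x b
∏-monomial x []          = refl
∏-monomial x (true ∷ b)  = cong (x zero *_) (∏-monomial (x ∘ suc) b)
∏-monomial x (false ∷ b) = trans (*-identityˡ _) (∏-monomial (x ∘ suc) b)

record GateEquations {V G : Set} (e : Enumeration G) (label : G → Label V) (edge : G → G → Bool)
                     (a : V → ℚ) (val : G → ℚ) : Set where
  field
    var-eq   : ∀ g v → label g ≡ var v → val g ≡ a v
    const-eq : ∀ g q → label g ≡ const q → val g ≡ q
    plus-eq  : ∀ g → label g ≡ plus → ∑+.∑⟨ e ⟩ (λ h → if edge h g then val h else 0ℚ) ≡ val g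
    times-eq : ∀ g → label g ≡ times → ∏*.∑⟨ e ⟩ (λ h → if edge h g then val h else 1ℚ) ≡ val g

module _ {V : Set} {s : ℕ} (C : Circuit V s) (a : V → ℚ) where
  open Circuit C
  open GateEquations

  evalF-equations : ∀ {val} → GateEquations (Fin-enum s) label edge a val →
                    ∀ k g → toℕ g ℕ.< k → evalF C a k g ≡ val g
  evalF-equations {val} eqs (suc k) g g<1+k with label g in label-g
  ... | var v   = sym (var-eq eqs g v label-g)
  ... | const q = sym (const-eq eqs g q label-g)
  ... | plus    = trans (∑+.foldr-tabulate (λ h → if edge h g then evalF C a k h else 0ℚ) id)
                        (trans (∑+.sum-cong-≗ (λ h → children h (edge h g) refl)) (plus-eq eqs g label-g))
    where
    children : ∀ h b → edge h g ≡ b → (if b then evalF C a k h else 0ℚ) ≡ (if b then val h else 0ℚ)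
    children h true  h→g = evalF-equations eqs k h (ℕ.<-≤-trans (acyclic h g h→g) (ℕ.≤-pred g<1+k))
    children h false _   = refl
  ... | times   = trans (∏*.foldr-tabulate (λ h → if edge h g then evalF C a k h else 1ℚ) id)
                        (trans (∏*.sum-cong-≗ (λ h → children h (edge h g) refl)) (times-eq eqs g label-g))
    where
    children : ∀ h b → edge h g ≡ b → (if b then evalF C a k h else 1ℚ) ≡ (if b then val h else 1ℚ)
    children h true  h→g = evalF-equations eqs k h (ℕ.<-≤-trans (acyclic h g h→g) (ℕ.≤-pred g<1+k))
    children h false _   = refl

  eval-equations : ∀ {val} → GateEquations (Fin-enum s) label edge a val → ∀ g → eval C a g ≡ val g
  eval-equations eqs g = evalF-equations eqs s g (toℕ<n g)

Adjacent : ∀ {G : Set} → (G → G → Bool) → G → G → Set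
Adjacent edge u v = edge u v ≡ true ⊎ edge v u ≡ true

record EnumeratedCircuit (V G : Set) : Set where
  field
    enum     : Enumeration G
    label    : G → Label V
    edge     : G → G → Bool
    acyclic  : ∀ x y → edge x y ≡ true → toℕ (index enum x) ℕ.< toℕ (index enum y)
    leaf⇒inp : ∀ x → (∀ y → edge y x ≡ false) → isLeafLabel (label x) ≡ true
    inp⇒leaf : ∀ x → isLeafLabel (label x) ≡ true → ∀ y → edge y x ≡ false
    hub      : G
    toHub    : ∀ x → Star (Adjacent edge) x hub

  circuit : Circuit V (size enum)
  circuit = record
    { label     = label ∘ element enum
    ; edge      = λ h g → edge (element enum h) (element enum g)
    ; acyclic   = λ h g h→g → subst₂ (λ u v → toℕ u ℕ.< toℕ v) (index-element enum h) (index-element enum g)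
                                      (acyclic (element enum h) (element enum g) h→g)
    ; leaf⇒inp  = λ g childless → leaf⇒inp (element enum g)
                    (λ y → subst (λ z → edge z (element enum g) ≡ false) (element-index enum y) (childless (index enum y)))
    ; inp⇒leaf  = λ g leaf h → inp⇒leaf (element enum g) leaf (element enum h)
    ; connected = λ g h → subst₂ (Star _) (index-element enum g) (index-element enum h)
                    (gmap (index enum) adjacent-index
                          (toHub (element enum g) ◅◅ reverse Adjacent-sym (toHub (element enum h))))
    }
    where
    Adjacent-sym : ∀ {x y} → Adjacent edge x y → Adjacent edge y x
    Adjacent-sym (inj₁ x→y) = inj₂ x→y
    Adjacent-sym (inj₂ y→x) = inj₁ y→x
    edge-index : ∀ {x y} → edge x y ≡ true → edge (element enum (index enum x)) (element enum (index enum y)) ≡ true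
    edge-index {x} {y} = subst₂ (λ u v → edge u v ≡ true) (sym (element-index enum x)) (sym (element-index enum y))
    adjacent-index : ∀ {x y} → Adjacent edge x y →
                     Adjacent (λ h g → edge (element enum h) (element enum g)) (index enum x) (index enum y)
    adjacent-index (inj₁ x→y) = inj₁ (edge-index x→y)
    adjacent-index (inj₂ y→x) = inj₂ (edge-index y→x)

  circuit-equations : ∀ {a val} → GateEquations enum label edge a val →
                      GateEquations (Fin-enum (size enum)) (Circuit.label circuit) (Circuit.edge circuit) a (val ∘ element enum)
  circuit-equations eqs = record
    { var-eq   = var-eq ∘ element enum
    ; const-eq = const-eq ∘ element enum
    ; plus-eq  = plus-eq ∘ element enum
    ; times-eq = times-eq ∘ element enum
    }
    where open GateEquations eqs

record Automorphism {n G} (C : EnumeratedCircuit (Var n) G) (π : Permutation′ (suc n)) (σ : Permutation′ n) : Set where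
  open EnumeratedCircuit C
  field
    act        : G → G
    act⁻¹      : G → G
    act-act⁻¹  : ∀ x → act (act⁻¹ x) ≡ x
    act⁻¹-act  : ∀ x → act⁻¹ (act x) ≡ x
    edge-pres  : ∀ x y → edge (act x) (act y) ≡ edge x y
    label-pres : ∀ x → label (act x) ≡ actLabel π σ (label x)

automorphism⇒extendsTo : ∀ {n G} {C : EnumeratedCircuit (Var n) G} {π σ} → Automorphism C π σ →
                         let open EnumeratedCircuit C in Σ (Permutation′ (size enum)) (ExtendsTo circuit π σ)
automorphism⇒extendsTo {G = G} {C = C} {π} {σ} τ = τ′ , record { edge-pres = edge-pres′ ; label-pres = label-pres′ }
  where
  open EnumeratedCircuit C
  open Automorphism τ
  conj : (G → G) → Fin (size enum) → Fin (size enum)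
  conj f = index enum ∘ f ∘ element enum
  conj-inverse : ∀ {f g} → (∀ x → f (g x) ≡ x) → ∀ i → conj f (conj g i) ≡ i
  conj-inverse {f} {g} f∘g i = trans (cong (index enum ∘ f) (element-index enum (g (element enum i))))
                                     (trans (cong (index enum) (f∘g (element enum i))) (index-element enum i))
  τ′ : Permutation′ (size enum)
  τ′ = permutation (conj act) (conj act⁻¹) (conj-inverse {act} {act⁻¹} act-act⁻¹) (conj-inverse {act⁻¹} {act} act⁻¹-act)
  edge-pres′ : ∀ h g → edge (element enum (conj act h)) (element enum (conj act g)) ≡ edge (element enum h) (element enum g)
  edge-pres′ h g = trans (cong₂ edge (element-index enum (act (element enum h))) (element-index enum (act (element enum g))))
                         (edge-pres (element enum h) (element enum g))
  label-pres′ : ∀ g → label (element enum (conj act g)) ≡ actLabel π σ (label (element enum g))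
  label-pres′ g = trans (cong label (element-index enum (act (element enum g)))) (label-pres (element enum g))

Word : ℕ → Set
Word m = Vec (Fin 3) m

-- A word w ∈ {0,1,2}^m encodes the disjoint pair (ones w , twos w) of subsets of [m].
isOne isTwo : Fin 3 → Bool
isOne 1F = true
isOne 0F = false
isOne 2F = false
isTwo 2F = true
isTwo 0F = false
isTwo 1F = false

lowerLetter raiseLetter : Fin 3 → Fin 3
lowerLetter 1F = 0F
lowerLetter 0F = 0F
lowerLetter 2F = 2F
raiseLetter 1F = 2F
raiseLetter 0F = 0F
raiseLetter 2F = 2F

module _ {m : ℕ} where

  ones twos : Word m → Subset m
  ones = Vec.map isOne
  twos = Vec.map isTwo

  lower raise : Word m → Word m
  lower = Vec.map lowerLetter
  raise = Vec.map raiseLetter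

  hasOne : Word m → Bool
  hasOne w = not (isEmpty (ones w))

  twosWord onesWord : Subset m → Word m
  twosWord = Vec.map (λ b → if b then 2F else 0F)
  onesWord = Vec.map (λ b → if b then 1F else 0F)

  zeros : Word m
  zeros = twosWord ∅

_≟ˢ_ : ∀ {m} → DecidableEquality (Subset m)
_≟ˢ_ = ≡-dec Data.Bool._≟_

_≟ʷ_ : ∀ {m} → DecidableEquality (Word m)
_≟ʷ_ = ≡-dec Fin._≟_

Word-enum : ∀ m → Enumeration (Word m)
Word-enum = Vec-enum (Fin-enum 3)

twosWord-twos : ∀ {m} (w : Word m) → hasOne w ≡ false → twosWord (twos w) ≡ w
twosWord-twos []       _       = refl
twosWord-twos (0F ∷ w) no-one = cong (0F ∷_) (twosWord-twos w no-one)
twosWord-twos (2F ∷ w) no-one = cong (2F ∷_) (twosWord-twos w no-one)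

∣ones∣≡0 : ∀ {m} (w : Word m) → hasOne w ≡ false → ∣ ones w ∣ ≡ 0
∣ones∣≡0 []       _      = refl
∣ones∣≡0 (0F ∷ w) no-one = ∣ones∣≡0 w no-one
∣ones∣≡0 (2F ∷ w) no-one = ∣ones∣≡0 w no-one

twos-twosWord : ∀ {m} (D : Subset m) → twos (twosWord D) ≡ D
twos-twosWord []          = refl
twos-twosWord (false ∷ D) = cong (false ∷_) (twos-twosWord D)
twos-twosWord (true ∷ D)  = cong (true ∷_) (twos-twosWord D)

hasOne-twosWord : ∀ {m} (D : Subset m) → hasOne (twosWord D) ≡ false
hasOne-twosWord []          = refl
hasOne-twosWord (false ∷ D) = hasOne-twosWord D
hasOne-twosWord (true ∷ D)  = hasOne-twosWord D

hasOne-lower : ∀ {m} (w : Word m) → hasOne (lower w) ≡ false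
hasOne-lower []       = refl
hasOne-lower (0F ∷ w) = hasOne-lower w
hasOne-lower (1F ∷ w) = hasOne-lower w
hasOne-lower (2F ∷ w) = hasOne-lower w

twos-lower : ∀ {m} (w : Word m) → twos (lower w) ≡ twos w
twos-lower []       = refl
twos-lower (0F ∷ w) = cong (false ∷_) (twos-lower w)
twos-lower (1F ∷ w) = cong (false ∷_) (twos-lower w)
twos-lower (2F ∷ w) = cong (true ∷_) (twos-lower w)

ones-onesWord : ∀ {m} (b : Subset m) → ones (onesWord b) ≡ b
ones-onesWord []          = refl
ones-onesWord (false ∷ b) = cong (false ∷_) (ones-onesWord b)
ones-onesWord (true ∷ b)  = cong (true ∷_) (ones-onesWord b)

lower-onesWord : ∀ {m} (b : Subset m) → lower (onesWord b) ≡ zeros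
lower-onesWord []          = refl
lower-onesWord (false ∷ b) = cong (0F ∷_) (lower-onesWord b)
lower-onesWord (true ∷ b)  = cong (0F ∷_) (lower-onesWord b)

raise-onesWord : ∀ {m} (b : Subset m) → raise (onesWord b) ≡ twosWord b
raise-onesWord []          = refl
raise-onesWord (false ∷ b) = cong (0F ∷_) (raise-onesWord b)
raise-onesWord (true ∷ b)  = cong (2F ∷_) (raise-onesWord b)

hasOne-onesWord : ∀ {m} (b : Subset m) → hasOne (onesWord b) ≡ not (isEmpty b)
hasOne-onesWord b = cong (not ∘ isEmpty) (ones-onesWord b)

lower-< : ∀ {m} (w : Word m) → hasOne w ≡ true → index (Word-enum m) (lower w) Fin.< index (Word-enum m) w
lower-< {suc m} (0F ∷ w) has = combine-monoʳ-< {3} 0F (lower-< w has)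
lower-< {suc m} (1F ∷ w) _   = combine-monoˡ-< {3} {size (Word-enum m)} {0F} {1F}
                                 (index (Word-enum m) (lower w)) (index (Word-enum m) w) (ℕ.s≤s ℕ.z≤n)
lower-< {suc m} (2F ∷ w) has = combine-monoʳ-< {3} 2F (lower-< w has)

raise-< : ∀ {m} (w : Word m) → hasOne w ≡ true → index (Word-enum m) w Fin.< index (Word-enum m) (raise w)
raise-< {suc m} (0F ∷ w) has = combine-monoʳ-< {3} 0F (raise-< w has)
raise-< {suc m} (1F ∷ w) _   = combine-monoˡ-< {3} {size (Word-enum m)} {1F} {2F}
                                 (index (Word-enum m) w) (index (Word-enum m) (raise w)) (ℕ.s≤s (ℕ.s≤s ℕ.z≤n))
raise-< {suc m} (2F ∷ w) has = combine-monoʳ-< {3} 2F (raise-< w has)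

∑-raise : ∀ {m} (H : SubsetFun₂ m) D →
          ∑+.∑⟨ Word-enum m ⟩ (λ w → if does (raise w ≟ʷ twosWord D) then H (ones w) (twos w) else 0ℚ) ≡ sumSplits H D
∑-raise {zero}  H []          = +-identityʳ (H [] [])
∑-raise {suc m} H (x ∷ D)     =
  trans (∑+.∑-× (Fin-enum 3) (Word-enum m) (λ (l , v) → summand x (l ∷ v))) (by-head x)
  where
  summand : Bool → Word (suc m) → ℚ
  summand x w = if does (raise w ≟ʷ twosWord (x ∷ D)) then H (ones w) (twos w) else 0ℚ
  none : ∑+.∑⟨ Word-enum m ⟩ (λ _ → 0ℚ) ≡ 0ℚ
  none = ∑+.∑-ε (Word-enum m) (λ _ → refl)
  by-head : ∀ x → ∑+.sum (λ l → ∑+.∑⟨ Word-enum m ⟩ (λ v → summand x (l ∷ v))) ≡ sumSplits H (x ∷ D)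
  by-head false = begin
      ∑+.∑⟨ Word-enum m ⟩ (λ v → summand false (0F ∷ v))
        + (∑+.∑⟨ Word-enum m ⟩ (λ _ → 0ℚ) + (∑+.∑⟨ Word-enum m ⟩ (λ _ → 0ℚ) + 0ℚ))
    ≡⟨ cong₂ _+_ (∑-raise (tail² false false H) D) (cong₂ _+_ none (cong (_+ 0ℚ) none)) ⟩
      sumSplits (tail² false false H) D + (0ℚ + (0ℚ + 0ℚ))
    ≡⟨ solve 1 (λ s → s :+ (con 0ℚ :+ (con 0ℚ :+ con 0ℚ)) := s) refl (sumSplits (tail² false false H) D) ⟩
      sumSplits (tail² false false H) D
    ∎
    where open ≡-Reasoning
  by-head true = begin
      ∑+.∑⟨ Word-enum m ⟩ (λ _ → 0ℚ)
        + (∑+.∑⟨ Word-enum m ⟩ (λ v → summand true (1F ∷ v)) + (∑+.∑⟨ Word-enum m ⟩ (λ v → summand true (2F ∷ v)) + 0ℚ))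
    ≡⟨ cong₂ _+_ none (cong₂ _+_ (∑-raise (tail² true false H) D) (cong (_+ 0ℚ) (∑-raise (tail² false true H) D))) ⟩
      0ℚ + (sumSplits (tail² true false H) D + (sumSplits (tail² false true H) D + 0ℚ))
    ≡⟨ solve 2 (λ s t → con 0ℚ :+ (s :+ (t :+ con 0ℚ)) := s :+ t) refl
             (sumSplits (tail² true false H) D) (sumSplits (tail² false true H) D) ⟩
      sumSplits H (true ∷ D)
    ∎
    where open ≡-Reasoning

permute : ∀ {A : Set} {m} → Permutation′ m → Vec A m → Vec A m
permute π v = Vec.tabulate (λ k → lookup v (π ⟨$⟩ˡ k))

lookup-permute : ∀ {A : Set} {m} (π : Permutation′ m) (v : Vec A m) i → lookup (permute π v) (π ⟨$⟩ʳ i) ≡ lookup v i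
lookup-permute π v i = trans (lookup∘tabulate _ (π ⟨$⟩ʳ i)) (cong (lookup v) (Perm.inverseˡ π))

permute-map : ∀ {A B : Set} {m} (π : Permutation′ m) (f : A → B) (v : Vec A m) →
              permute π (Vec.map f v) ≡ Vec.map f (permute π v)
permute-map π f v = trans (tabulate-cong (λ k → lookup-map (π ⟨$⟩ˡ k) f v)) (tabulate-∘ f _)

permute-flip : ∀ {A : Set} {m} (π : Permutation′ m) (v : Vec A m) → permute π (permute (Perm.flip π) v) ≡ v
permute-flip π v = trans (tabulate-cong (λ k → trans (lookup∘tabulate _ (π ⟨$⟩ˡ k)) (cong (lookup v) (Perm.inverseʳ π))))
                         (tabulate∘lookup v)

flip-permute : ∀ {A : Set} {m} (π : Permutation′ m) (v : Vec A m) → permute (Perm.flip π) (permute π v) ≡ v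
flip-permute π v = trans (tabulate-cong (lookup-permute π v)) (tabulate∘lookup v)

permute-injective : ∀ {A : Set} {m} (π : Permutation′ m) {u v : Vec A m} → permute π u ≡ permute π v → u ≡ v
permute-injective π {u} {v} eq = trans (sym (flip-permute π u)) (trans (cong (permute (Perm.flip π)) eq) (flip-permute π v))

Bool-ext : ∀ {x y : Bool} → (x ≡ true → y ≡ true) → (y ≡ true → x ≡ true) → x ≡ y
Bool-ext {false} {false} _ _ = refl
Bool-ext {false} {true}  _ y⇒x = y⇒x refl
Bool-ext {true}  {false} x⇒y _ = sym (x⇒y refl)
Bool-ext {true}  {true}  _ _ = refl

does⇒witness : ∀ {A : Set} (a? : Dec A) → does a? ≡ true → A
does⇒witness (yes a) _ = a

does-≟-injective : ∀ {A B : Set} (_≟ᴬ_ : DecidableEquality A) (_≟ᴮ_ : DecidableEquality B) (f : A → B) →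
                   (∀ {x y} → f x ≡ f y → x ≡ y) → ∀ x y → does (f x ≟ᴮ f y) ≡ does (x ≟ᴬ y)
does-≟-injective _≟ᴬ_ _≟ᴮ_ f f-injective x y = does-⇔ (mk⇔ f-injective (cong f)) (f x ≟ᴮ f y) (x ≟ᴬ y)

∣b∣≡sum : ∀ {m} (b : Subset m) → ∣ b ∣ ≡ ℕ+.sum (λ i → if lookup b i then 1 else 0)
∣b∣≡sum []          = refl
∣b∣≡sum (false ∷ b) = ∣b∣≡sum b
∣b∣≡sum (true ∷ b)  = cong suc (∣b∣≡sum b)

∣permute∣ : ∀ {m} (π : Permutation′ m) (b : Subset m) → ∣ permute π b ∣ ≡ ∣ b ∣
∣permute∣ π b = begin
    ∣ permute π b ∣
  ≡⟨ ∣b∣≡sum (permute π b) ⟩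
    ℕ+.sum (λ k → if lookup (permute π b) k then 1 else 0)
  ≡⟨ ℕ+.sum-cong-≗ (λ k → cong (λ t → if t then 1 else 0) (lookup∘tabulate (λ k → lookup b (π ⟨$⟩ˡ k)) k)) ⟩
    ℕ+.sum (λ k → if lookup b (π ⟨$⟩ˡ k) then 1 else 0)
  ≡⟨ ℕ+.sum-permute (λ i → if lookup b i then 1 else 0) (Perm.flip π) ⟨
    ℕ+.sum (λ i → if lookup b i then 1 else 0)
  ≡⟨ ∣b∣≡sum b ⟨
    ∣ b ∣
  ∎
  where open ≡-Reasoning

-- The circuit

module Construction (n′ : ℕ) where

  n m : ℕ
  n = suc n′
  m = suc n

  Gate : Set
  Gate = (Fin m × Fin n) ⊎ (Subset m × Fin n) ⊎ Subset m ⊎ Word m ⊎ Word m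

  pattern inputG i j = inj₁ (i , j)
  pattern monoG b j  = inj₂ (inj₁ (b , j))
  pattern powerG b   = inj₂ (inj₂ (inj₁ b))
  pattern coeffG w   = inj₂ (inj₂ (inj₂ (inj₁ w)))
  pattern wordG w    = inj₂ (inj₂ (inj₂ (inj₂ w)))

  Subset-enum : Enumeration (Subset m)
  Subset-enum = Vec-enum Bool-enum m

  Input-enum : Enumeration (Fin m × Fin n)
  Input-enum = Fin-enum m ×-enum Fin-enum n

  Mono-enum : Enumeration (Subset m × Fin n)
  Mono-enum = Subset-enum ×-enum Fin-enum n

  Upper₃ : Enumeration (Word m ⊎ Word m)
  Upper₃ = Word-enum m ⊎-enum Word-enum m

  Upper₂ : Enumeration (Subset m ⊎ Word m ⊎ Word m)
  Upper₂ = Subset-enum ⊎-enum Upper₃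

  Upper₁ : Enumeration ((Subset m × Fin n) ⊎ Subset m ⊎ Word m ⊎ Word m)
  Upper₁ = Mono-enum ⊎-enum Upper₂

  Gate-enum : Enumeration Gate
  Gate-enum = Input-enum ⊎-enum Upper₁

  coeff : Word m → ℚ
  coeff w = if hasOne w then logCoeff ∣ ones w ∣ * recip (∣ ones w ∣ ℕ.+ ∣ twos w ∣) else δ (twos w)

  -- A word w with a 1 is the summand coeff w · p_(ones w) · B_(twos w) of Newton's identity for
  -- D = ones w ∪ twos w, where B_(twos w) is read off lower w; a word w without a 1 computes
  -- B_(twos w) as δ plus the summands w′ with raise w′ = w.
  edge : Gate → Gate → Bool
  edge (inputG i j′) (monoG b j) = lookup b i ∧ does (j′ Fin.≟ j)
  edge (monoG b j)   (powerG b′) = does (b ≟ˢ b′)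
  edge (powerG b)    (wordG w)   = does (b ≟ˢ ones w)
  edge (coeffG w)    (wordG w′)  = does (w ≟ʷ w′)
  edge (wordG w)     (wordG w′)  = if hasOne w′ then does (w ≟ʷ lower w′) else hasOne w ∧ does (raise w ≟ʷ w′)
  edge _             _           = false

  -- A childless times gate is not allowed, so the empty monomial gate is a constant; taking it 0
  -- rather than 1 makes powerG ∅, a child of every word gate without a 1, contribute nothing.
  label : Gate → Label (Var n)
  label (inputG i j) = var (i , j)
  label (monoG b j)  = if isEmpty b then const 0ℚ else times
  label (powerG b)   = plus
  label (coeffG w)   = const (coeff w)
  label (wordG w)    = if hasOne w then times else plus

  data Wire : Gate → Gate → Set where
    input-mono : ∀ {i j b} → lookup b i ≡ true → Wire (inputG i j) (monoG b j)
    mono-power : ∀ {b j} → Wire (monoG b j) (powerG b)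
    power-word : ∀ {w} → Wire (powerG (ones w)) (wordG w)
    coeff-word : ∀ {w} → Wire (coeffG w) (wordG w)
    word-word  : ∀ {w w′} → edge (wordG w) (wordG w′) ≡ true → Wire (wordG w) (wordG w′)

  wire : ∀ x y → edge x y ≡ true → Wire x y
  wire (inputG i j′) (monoG b j) e with lookup b i in b∋i | j′ Fin.≟ j
  ... | true | yes refl = input-mono b∋i
  wire (monoG b j)   (powerG b′) e with b ≟ˢ b′
  ... | yes refl = mono-power
  wire (powerG b)    (wordG w)   e with b ≟ˢ ones w
  ... | yes refl = power-word
  wire (coeffG w)    (wordG w′)  e with w ≟ʷ w′
  ... | yes refl = coeff-word
  wire (wordG w)     (wordG w′)  e = word-word e

  word-edge-< : ∀ w w′ → edge (wordG w) (wordG w′) ≡ true → index (Word-enum m) w Fin.< index (Word-enum m) w′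
  word-edge-< w w′ w→w′ with hasOne w′ in has′
  ... | true  = subst (λ u → index (Word-enum m) u Fin.< index (Word-enum m) w′)
                      (sym (does⇒witness (w ≟ʷ lower w′) w→w′)) (lower-< w′ has′)
  ... | false with hasOne w in has
  ...   | true  = subst (λ u → index (Word-enum m) w Fin.< index (Word-enum m) u)
                        (does⇒witness (raise w ≟ʷ w′) w→w′) (raise-< w has)

  acyclic : ∀ x y → edge x y ≡ true → index Gate-enum x Fin.< index Gate-enum y
  acyclic x y x→y = wire-< (wire x y x→y)
    where
    up₁ : ∀ y y′ → index Upper₁ y Fin.< index Upper₁ y′ → index Gate-enum (inj₂ y) Fin.< index Gate-enum (inj₂ y′)
    up₁ = index-inj₂-mono Input-enum Upper₁
    up₂ : ∀ y y′ → index Upper₂ y Fin.< index Upper₂ y′ → index Upper₁ (inj₂ y) Fin.< index Upper₁ (inj₂ y′)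
    up₂ = index-inj₂-mono Mono-enum Upper₂
    up₃ : ∀ y y′ → index Upper₃ y Fin.< index Upper₃ y′ → index Upper₂ (inj₂ y) Fin.< index Upper₂ (inj₂ y′)
    up₃ = index-inj₂-mono Subset-enum Upper₃
    wire-< : ∀ {x y} → Wire x y → index Gate-enum x Fin.< index Gate-enum y
    wire-< (input-mono {i} {j} {b} _) = index-inj₁<inj₂ Input-enum Upper₁ (i , j) (inj₁ (b , j))
    wire-< (mono-power {b} {j}) =
      up₁ (inj₁ (b , j)) (inj₂ (inj₁ b)) (index-inj₁<inj₂ Mono-enum Upper₂ (b , j) (inj₁ b))
    wire-< (power-word {w}) =
      up₁ (inj₂ (inj₁ (ones w))) (inj₂ (inj₂ (inj₂ w)))
          (up₂ (inj₁ (ones w)) (inj₂ (inj₂ w)) (index-inj₁<inj₂ Subset-enum Upper₃ (ones w) (inj₂ w)))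
    wire-< (coeff-word {w}) =
      up₁ (inj₂ (inj₂ (inj₁ w))) (inj₂ (inj₂ (inj₂ w)))
          (up₂ (inj₂ (inj₁ w)) (inj₂ (inj₂ w))
               (up₃ (inj₁ w) (inj₂ w) (index-inj₁<inj₂ (Word-enum m) (Word-enum m) w w)))
    wire-< (word-word {w} {w′} w→w′) =
      up₁ (inj₂ (inj₂ (inj₂ w))) (inj₂ (inj₂ (inj₂ w′)))
          (up₂ (inj₂ (inj₂ w)) (inj₂ (inj₂ w′))
               (up₃ (inj₂ w) (inj₂ w′) (index-inj₂-mono (Word-enum m) (Word-enum m) w w′ (word-edge-< w w′ w→w′))))

  times-or-plus-internal : ∀ t → isLeafLabel {Var n} (if t then times else plus) ≡ false
  times-or-plus-internal true  = refl
  times-or-plus-internal false = refl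

  wire-target-internal : ∀ {x y} → Wire x y → isLeafLabel (label y) ≡ false
  wire-target-internal (input-mono {i} {j} {b} b∋i) with isEmpty b in empty
  ... | true with trans (sym b∋i) (isEmpty-lookup b empty i)
  ...   | ()
  wire-target-internal (input-mono _) | false = refl
  wire-target-internal mono-power         = refl
  wire-target-internal (power-word {w})   = times-or-plus-internal (hasOne w)
  wire-target-internal (coeff-word {w})   = times-or-plus-internal (hasOne w)
  wire-target-internal (word-word {w′ = w′} _) = times-or-plus-internal (hasOne w′)

  inp⇒leaf : ∀ x → isLeafLabel (label x) ≡ true → ∀ y → edge y x ≡ false
  inp⇒leaf x leaf y with edge y x in y→x
  ... | false = refl
  ... | true with trans (sym leaf) (wire-target-internal (wire y x y→x))
  ...   | ()

  leaf⇒inp : ∀ x → (∀ y → edge y x ≡ false) → isLeafLabel (label x) ≡ true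
  leaf⇒inp (inputG i j) _ = refl
  leaf⇒inp (coeffG w)   _ = refl
  leaf⇒inp (monoG b j) childless with isEmpty b in empty
  ... | true  = refl
  ... | false with nonempty-lookup b empty
  ...   | i , b∋i with trans (sym (childless (inputG i j))) (cong₂ _∧_ b∋i (dec-true (j Fin.≟ j) refl))
  ...     | ()
  leaf⇒inp (powerG b) childless with trans (sym (childless (monoG b zero))) (dec-true (b ≟ˢ b) refl)
  ... | ()
  leaf⇒inp (wordG w) childless with trans (sym (childless (coeffG w))) (dec-true (w ≟ʷ w) refl)
  ... | ()

  hub : Gate
  hub = wordG zeros

  forward : ∀ {x y} → edge x y ≡ true → Star (Adjacent edge) x y
  forward x→y = inj₁ x→y ◅ ε

  backward : ∀ {x y} → edge y x ≡ true → Star (Adjacent edge) x y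
  backward y→x = inj₂ y→x ◅ ε

  subsetWord-to-hub : ∀ D → Star (Adjacent edge) (wordG (twosWord D)) hub
  subsetWord-to-hub D with isEmpty D in empty
  ... | true  = subst (λ D → Star (Adjacent edge) (wordG (twosWord D)) hub) (sym (isEmpty⇒≡∅ D empty)) ε
  ... | false = backward {y = wordG (onesWord D)} onesWord→twosWord ◅◅ backward zeros→onesWord
    where
    onesWord→twosWord : edge (wordG (onesWord D)) (wordG (twosWord D)) ≡ true
    onesWord→twosWord rewrite hasOne-twosWord D | hasOne-onesWord D | empty | raise-onesWord D =
      dec-true (twosWord D ≟ʷ twosWord D) refl
    zeros→onesWord : edge hub (wordG (onesWord D)) ≡ true
    zeros→onesWord rewrite hasOne-onesWord D | empty | lower-onesWord D = dec-true (zeros {m} ≟ʷ zeros) refl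

  word-to-hub : ∀ w → Star (Adjacent edge) (wordG w) hub
  word-to-hub w with hasOne w in has
  ... | false = subst (λ u → Star (Adjacent edge) (wordG u) hub) (twosWord-twos w has) (subsetWord-to-hub (twos w))
  ... | true  = backward {y = wordG (lower w)} lower→w ◅◅ subst (λ u → Star (Adjacent edge) (wordG u) hub)
                                          (twosWord-twos (lower w) (hasOne-lower w)) (subsetWord-to-hub (twos (lower w)))
    where
    lower→w : edge (wordG (lower w)) (wordG w) ≡ true
    lower→w rewrite has = dec-true (lower w ≟ʷ lower w) refl

  power-to-hub : ∀ b → Star (Adjacent edge) (powerG b) hub
  power-to-hub b = forward {y = wordG (onesWord b)} (subst (λ c → does (b ≟ˢ c) ≡ true) (sym (ones-onesWord b)) (dec-true (b ≟ˢ b) refl))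
                   ◅◅ word-to-hub (onesWord b)

  to-hub : ∀ x → Star (Adjacent edge) x hub
  to-hub (inputG i j) = forward {y = monoG full j} input→full ◅◅ forward {y = powerG full} (dec-true (full ≟ˢ full) refl)
                        ◅◅ power-to-hub full
    where
    full : Subset m
    full = replicate m true
    input→full : edge (inputG i j) (monoG full j) ≡ true
    input→full rewrite lookup-replicate i true = dec-true (j Fin.≟ j) refl
  to-hub (monoG b j) = forward {y = powerG b} (dec-true (b ≟ˢ b) refl) ◅◅ power-to-hub b
  to-hub (powerG b)  = power-to-hub b
  to-hub (coeffG w)  = forward {y = wordG w} (dec-true (w ≟ʷ w) refl) ◅◅ word-to-hub w
  to-hub (wordG w)   = word-to-hub w

  gates : EnumeratedCircuit (Var n) Gate
  gates = record
    { enum = Gate-enum ; label = label ; edge = edge ; acyclic = acyclic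
    ; leaf⇒inp = leaf⇒inp ; inp⇒leaf = inp⇒leaf ; hub = hub ; toHub = to-hub }

  module _ (π : Permutation′ m) where

    ones-permute : ∀ w → ones (permute π w) ≡ permute π (ones w)
    ones-permute w = sym (permute-map π isOne w)

    twos-permute : ∀ w → twos (permute π w) ≡ permute π (twos w)
    twos-permute w = sym (permute-map π isTwo w)

    lower-permute : ∀ w → lower (permute π w) ≡ permute π (lower w)
    lower-permute w = sym (permute-map π lowerLetter w)

    raise-permute : ∀ w → raise (permute π w) ≡ permute π (raise w)
    raise-permute w = sym (permute-map π raiseLetter w)

    isEmpty-permute : ∀ b → isEmpty (permute π b) ≡ isEmpty b
    isEmpty-permute b = cong (ℕ._≡ᵇ 0) (∣permute∣ π b)

    hasOne-permute : ∀ w → hasOne (permute π w) ≡ hasOne w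
    hasOne-permute w = cong not (trans (cong isEmpty (ones-permute w)) (isEmpty-permute (ones w)))

    coeff-permute : ∀ w → coeff (permute π w) ≡ coeff w
    coeff-permute w = trans
      (cong₂ (λ t e → if t then logCoeff ∣ ones (permute π w) ∣ * recip (∣ ones (permute π w) ∣ ℕ.+ ∣ twos (permute π w) ∣)
                           else (if e then 1ℚ else 0ℚ))
             (hasOne-permute w) (trans (cong isEmpty (twos-permute w)) (isEmpty-permute (twos w))))
      (cong₂ (λ k l → if hasOne w then logCoeff k * recip (k ℕ.+ l) else δ (twos w))
             (trans (cong ∣_∣ (ones-permute w)) (∣permute∣ π (ones w)))
             (trans (cong ∣_∣ (twos-permute w)) (∣permute∣ π (twos w))))

    ≟ʷ-permute : ∀ u v → does (permute π u ≟ʷ permute π v) ≡ does (u ≟ʷ v)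
    ≟ʷ-permute = does-≟-injective _≟ʷ_ _≟ʷ_ (permute π) (permute-injective π)

    word-edge-permute : ∀ w w′ → edge (wordG (permute π w)) (wordG (permute π w′)) ≡ edge (wordG w) (wordG w′)
    word-edge-permute w w′ =
      trans (cong (λ t → if t then does (permute π w ≟ʷ lower (permute π w′))
                              else hasOne (permute π w) ∧ does (raise (permute π w) ≟ʷ permute π w′))
                  (hasOne-permute w′))
            (cong₂ (λ x y → if hasOne w′ then x else y)
                   (trans (cong (λ u → does (permute π w ≟ʷ u)) (lower-permute w′)) (≟ʷ-permute w (lower w′)))
                   (cong₂ _∧_ (hasOne-permute w)
                              (trans (cong (λ u → does (u ≟ʷ permute π w′)) (raise-permute w)) (≟ʷ-permute (raise w) w′))))

  act : Permutation′ m → Permutation′ n → Gate → Gate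
  act π σ (inputG i j) = inputG (π ⟨$⟩ʳ i) (σ ⟨$⟩ʳ j)
  act π σ (monoG b j)  = monoG (permute π b) (σ ⟨$⟩ʳ j)
  act π σ (powerG b)   = powerG (permute π b)
  act π σ (coeffG w)   = coeffG (permute π w)
  act π σ (wordG w)    = wordG (permute π w)

  act-flip : ∀ π σ x → act π σ (act (Perm.flip π) (Perm.flip σ) x) ≡ x
  act-flip π σ (inputG i j) = cong₂ inputG (Perm.inverseʳ π) (Perm.inverseʳ σ)
  act-flip π σ (monoG b j)  = cong₂ monoG (permute-flip π b) (Perm.inverseʳ σ)
  act-flip π σ (powerG b)   = cong powerG (permute-flip π b)
  act-flip π σ (coeffG w)   = cong coeffG (permute-flip π w)
  act-flip π σ (wordG w)    = cong wordG (permute-flip π w)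

  flip-act : ∀ π σ x → act (Perm.flip π) (Perm.flip σ) (act π σ x) ≡ x
  flip-act π σ (inputG i j) = cong₂ inputG (Perm.inverseˡ π) (Perm.inverseˡ σ)
  flip-act π σ (monoG b j)  = cong₂ monoG (flip-permute π b) (Perm.inverseˡ σ)
  flip-act π σ (powerG b)   = cong powerG (flip-permute π b)
  flip-act π σ (coeffG w)   = cong coeffG (flip-permute π w)
  flip-act π σ (wordG w)    = cong wordG (flip-permute π w)

  edge-act : ∀ π σ x y → edge x y ≡ true → edge (act π σ x) (act π σ y) ≡ true
  edge-act π σ x y x→y = wire-act (wire x y x→y)
    where
    wire-act : ∀ {x y} → Wire x y → edge (act π σ x) (act π σ y) ≡ true
    wire-act (input-mono {i} {j} {b} b∋i) =
      cong₂ _∧_ (trans (lookup-permute π b i) b∋i) (dec-true (σ ⟨$⟩ʳ j Fin.≟ σ ⟨$⟩ʳ j) refl)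
    wire-act (mono-power {b})          = dec-true (permute π b ≟ˢ permute π b) refl
    wire-act (power-word {w})          = subst (λ c → does (permute π (ones w) ≟ˢ c) ≡ true) (sym (ones-permute π w))
                                               (dec-true (permute π (ones w) ≟ˢ permute π (ones w)) refl)
    wire-act (coeff-word {w})          = dec-true (permute π w ≟ʷ permute π w) refl
    wire-act (word-word {w} {w′} w→w′) = trans (word-edge-permute π w w′) w→w′

  actLabel-if : ∀ π σ t (l l′ : Label (Var n)) →
                (if t then actLabel π σ l else actLabel π σ l′) ≡ actLabel π σ (if t then l else l′)
  actLabel-if π σ true  l l′ = refl
  actLabel-if π σ false l l′ = refl

  label-act : ∀ π σ x → label (act π σ x) ≡ actLabel π σ (label x)
  label-act π σ (inputG i j) = refl
  label-act π σ (monoG b j)  = trans (cong (λ t → if t then const 0ℚ else times) (isEmpty-permute π b))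
                                     (actLabel-if π σ (isEmpty b) (const 0ℚ) times)
  label-act π σ (powerG b)   = refl
  label-act π σ (coeffG w)   = cong const (coeff-permute π w)
  label-act π σ (wordG w)    = trans (cong (λ t → if t then times else plus) (hasOne-permute π w))
                                     (actLabel-if π σ (hasOne w) times plus)

  automorphism : ∀ π σ → Automorphism gates π σ
  automorphism π σ = record
    { act        = act π σ
    ; act⁻¹      = act (Perm.flip π) (Perm.flip σ)
    ; act-act⁻¹  = act-flip π σ
    ; act⁻¹-act  = flip-act π σ
    ; edge-pres  = λ x y → Bool-ext (λ e → subst₂ (λ u v → edge u v ≡ true) (flip-act π σ x) (flip-act π σ y)
                                             (edge-act (Perm.flip π) (Perm.flip σ) (act π σ x) (act π σ y) e))
                                    (edge-act π σ x y)
    ; label-pres = label-act π σ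
    }

  edge-into-term : ∀ w → hasOne w ≡ true → ∀ w′ → edge (wordG w′) (wordG w) ≡ does (w′ ≟ʷ lower w)
  edge-into-term w has w′ = cong (λ t → if t then does (w′ ≟ʷ lower w) else hasOne w′ ∧ does (raise w′ ≟ʷ w)) has

  edge-into-subset : ∀ w → hasOne w ≡ false → ∀ w′ → edge (wordG w′) (wordG w) ≡ hasOne w′ ∧ does (raise w′ ≟ʷ w)
  edge-into-subset w no-one w′ = cong (λ t → if t then does (w′ ≟ʷ lower w) else hasOne w′ ∧ does (raise w′ ≟ʷ w)) no-one

  module GateSum {A : Set} {_∙_ : A → A → A} {ε : A} (isCM : IsCommutativeMonoid _≡_ _∙_ ε) where
    open BigOperator isCM

    ∑-Gate : ∀ f → ∑⟨ Gate-enum ⟩ f ≡ ∑⟨ Input-enum ⟩ (f ∘ inj₁) ∙ (∑⟨ Mono-enum ⟩ (f ∘ inj₂ ∘ inj₁) ∙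
                     (∑⟨ Subset-enum ⟩ (f ∘ powerG) ∙ (∑⟨ Word-enum m ⟩ (f ∘ coeffG) ∙ ∑⟨ Word-enum m ⟩ (f ∘ wordG))))
    ∑-Gate f =
      trans (∑-⊎ Input-enum Upper₁ f) (cong (∑⟨ Input-enum ⟩ (f ∘ inj₁) ∙_)
      (trans (∑-⊎ Mono-enum Upper₂ (f ∘ inj₂)) (cong (∑⟨ Mono-enum ⟩ (f ∘ inj₂ ∘ inj₁) ∙_)
      (trans (∑-⊎ Subset-enum Upper₃ (f ∘ inj₂ ∘ inj₂)) (cong (∑⟨ Subset-enum ⟩ (f ∘ powerG) ∙_)
      (∑-⊎ (Word-enum m) (Word-enum m) (f ∘ inj₂ ∘ inj₂ ∘ inj₂)))))))

  module Evaluation (a : Var n → ℚ) where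
    open Columns {n} using (column)
    open Newton {n}

    a′ : Fin m → Fin n → ℚ
    a′ i j = a (i , j)

    monoValue : Subset m → Fin n → ℚ
    monoValue b j = if isEmpty b then 0ℚ else monomial (column a′ j) b

    powerValue : Subset m → ℚ
    powerValue b = ∑+.sum (monoValue b)

    wordValue : Word m → ℚ
    wordValue w = if hasOne w then coeff w * powerValue (ones w) * injectiveSum a′ (twos w) else injectiveSum a′ (twos w)

    value : Gate → ℚ
    value (inputG i j) = a (i , j)
    value (monoG b j)  = monoValue b j
    value (powerG b)   = powerValue b
    value (coeffG w)   = coeff w
    value (wordG w)    = wordValue w

    ∑children : Gate → ℚ
    ∑children g = ∑+.∑⟨ Gate-enum ⟩ (λ h → if edge h g then value h else 0ℚ)

    ∏children : Gate → ℚ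
    ∏children g = ∏*.∑⟨ Gate-enum ⟩ (λ h → if edge h g then value h else 1ℚ)

    powerValue-∅ : ∀ b → isEmpty b ≡ true → powerValue b ≡ 0ℚ
    powerValue-∅ b empty = ∑+.sum-ε (λ j → cong (λ t → if t then 0ℚ else monomial (column a′ j) b) empty)

    power-children : ∀ b → ∑children (powerG b) ≡ powerValue b
    power-children b = begin
        ∑children (powerG b)
      ≡⟨ GateSum.∑-Gate +-0-isCommutativeMonoid (λ h → if edge h (powerG b) then value h else 0ℚ) ⟩
        ∑+.∑⟨ Input-enum ⟩ (λ _ → 0ℚ) + (monomials + (∑+.∑⟨ Subset-enum ⟩ (λ _ → 0ℚ)
          + (∑+.∑⟨ Word-enum m ⟩ (λ _ → 0ℚ) + ∑+.∑⟨ Word-enum m ⟩ (λ _ → 0ℚ))))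
      ≡⟨ cong₂ _+_ (∑+.∑-ε Input-enum (λ _ → refl))
                   (cong₂ _+_ monomials≡ (cong₂ _+_ (∑+.∑-ε Subset-enum (λ _ → refl))
                     (cong₂ _+_ (∑+.∑-ε (Word-enum m) (λ _ → refl)) (∑+.∑-ε (Word-enum m) (λ _ → refl))))) ⟩
        0ℚ + (powerValue b + (0ℚ + (0ℚ + 0ℚ)))
      ≡⟨ solve 1 (λ x → con 0ℚ :+ (x :+ (con 0ℚ :+ (con 0ℚ :+ con 0ℚ))) := x) refl (powerValue b) ⟩
        powerValue b
      ∎
      where
      open ≡-Reasoning
      monomials : ℚ
      monomials = ∑+.∑⟨ Mono-enum ⟩ (λ (b′ , j) → if does (b′ ≟ˢ b) then monoValue b′ j else 0ℚ)
      monomials≡ : monomials ≡ powerValue b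
      monomials≡ =
        trans (∑+.∑-× Subset-enum (Fin-enum n) (λ (b′ , j) → if does (b′ ≟ˢ b) then monoValue b′ j else 0ℚ))
              (trans (∑+.∑-cong Subset-enum (λ b′ → ∑+.sum-if (does (b′ ≟ˢ b)) (monoValue b′)))
                     (∑+.∑-δ Subset-enum _≟ˢ_ b powerValue))

    mono-children : ∀ b j → isEmpty b ≡ false → ∏children (monoG b j) ≡ monoValue b j
    mono-children b j nonempty = begin
        ∏children (monoG b j)
      ≡⟨ GateSum.∑-Gate *-1-isCommutativeMonoid (λ h → if edge h (monoG b j) then value h else 1ℚ) ⟩
        inputs * (∏*.∑⟨ Mono-enum ⟩ (λ _ → 1ℚ) * (∏*.∑⟨ Subset-enum ⟩ (λ _ → 1ℚ)
          * (∏*.∑⟨ Word-enum m ⟩ (λ _ → 1ℚ) * ∏*.∑⟨ Word-enum m ⟩ (λ _ → 1ℚ))))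
      ≡⟨ cong₂ _*_ inputs≡ (cong₂ _*_ (∏*.∑-ε Mono-enum (λ _ → refl)) (cong₂ _*_ (∏*.∑-ε Subset-enum (λ _ → refl))
                     (cong₂ _*_ (∏*.∑-ε (Word-enum m) (λ _ → refl)) (∏*.∑-ε (Word-enum m) (λ _ → refl))))) ⟩
        monomial (column a′ j) b * (1ℚ * (1ℚ * (1ℚ * 1ℚ)))
      ≡⟨ solve 1 (λ x → x :* (con 1ℚ :* (con 1ℚ :* (con 1ℚ :* con 1ℚ))) := x) refl (monomial (column a′ j) b) ⟩
        monomial (column a′ j) b
      ≡⟨ cong (λ t → if t then 0ℚ else monomial (column a′ j) b) nonempty ⟨
        monoValue b j
      ∎
      where
      open ≡-Reasoning
      inputs : ℚ
      inputs = ∏*.∑⟨ Input-enum ⟩ (λ (i , j′) → if lookup b i ∧ does (j′ Fin.≟ j) then a (i , j′) else 1ℚ)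
      row : ∀ i → ∏*.sum (λ j′ → if lookup b i ∧ does (j′ Fin.≟ j) then a (i , j′) else 1ℚ)
                  ≡ (if lookup b i then a (i , j) else 1ℚ)
      row i with lookup b i
      ... | true  = ∏*.∑-δ (Fin-enum n) Fin._≟_ j (λ j′ → a (i , j′))
      ... | false = ∏*.sum-ε {n} (λ _ → refl)
      inputs≡ : inputs ≡ monomial (column a′ j) b
      inputs≡ = trans (∏*.∑-× (Fin-enum m) (Fin-enum n) (λ (i , j′) → if lookup b i ∧ does (j′ Fin.≟ j) then a (i , j′) else 1ℚ))
                      (trans (∏*.sum-cong-≗ row) (∏-monomial (column a′ j) b))

    lowered-product : ∀ w → hasOne w ≡ true →
                      ∏*.∑⟨ Word-enum m ⟩ (λ w′ → if edge (wordG w′) (wordG w) then wordValue w′ else 1ℚ)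
                      ≡ injectiveSum a′ (twos w)
    lowered-product w has = begin
        ∏*.∑⟨ Word-enum m ⟩ (λ w′ → if edge (wordG w′) (wordG w) then wordValue w′ else 1ℚ)
      ≡⟨ ∏*.∑-cong (Word-enum m) (λ w′ → cong (λ t → if t then wordValue w′ else 1ℚ) (edge-into-term w has w′)) ⟩
        ∏*.∑⟨ Word-enum m ⟩ (λ w′ → if does (w′ ≟ʷ lower w) then wordValue w′ else 1ℚ)
      ≡⟨ ∏*.∑-δ (Word-enum m) _≟ʷ_ (lower w) wordValue ⟩
        wordValue (lower w)
      ≡⟨ cong (λ t → if t then coeff (lower w) * powerValue (ones (lower w)) * injectiveSum a′ (twos (lower w))
                          else injectiveSum a′ (twos (lower w))) (hasOne-lower w) ⟩
        injectiveSum a′ (twos (lower w))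
      ≡⟨ cong (injectiveSum a′) (twos-lower w) ⟩
        injectiveSum a′ (twos w)
      ∎
      where open ≡-Reasoning

    term-children : ∀ w → hasOne w ≡ true → ∏children (wordG w) ≡ wordValue w
    term-children w has = begin
        ∏children (wordG w)
      ≡⟨ GateSum.∑-Gate *-1-isCommutativeMonoid (λ h → if edge h (wordG w) then value h else 1ℚ) ⟩
        ∏*.∑⟨ Input-enum ⟩ (λ _ → 1ℚ) * (∏*.∑⟨ Mono-enum ⟩ (λ _ → 1ℚ) * (power * (coefficient *
          ∏*.∑⟨ Word-enum m ⟩ (λ w′ → if edge (wordG w′) (wordG w) then wordValue w′ else 1ℚ))))
      ≡⟨ cong₂ _*_ (∏*.∑-ε Input-enum (λ _ → refl)) (cong₂ _*_ (∏*.∑-ε Mono-enum (λ _ → refl))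
                     (cong₂ _*_ power≡ (cong₂ _*_ coefficient≡ (lowered-product w has)))) ⟩
        1ℚ * (1ℚ * (powerValue (ones w) * (coeff w * injectiveSum a′ (twos w))))
      ≡⟨ solve 3 (λ p k b → con 1ℚ :* (con 1ℚ :* (p :* (k :* b))) := k :* p :* b) refl
               (powerValue (ones w)) (coeff w) (injectiveSum a′ (twos w)) ⟩
        coeff w * powerValue (ones w) * injectiveSum a′ (twos w)
      ≡⟨ cong (λ t → if t then coeff w * powerValue (ones w) * injectiveSum a′ (twos w) else injectiveSum a′ (twos w)) has ⟨
        wordValue w
      ∎
      where
      open ≡-Reasoning
      power coefficient : ℚ
      power       = ∏*.∑⟨ Subset-enum ⟩ (λ b → if does (b ≟ˢ ones w) then powerValue b else 1ℚ)
      coefficient = ∏*.∑⟨ Word-enum m ⟩ (λ w′ → if does (w′ ≟ʷ w) then coeff w′ else 1ℚ)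
      power≡ : power ≡ powerValue (ones w)
      power≡ = ∏*.∑-δ Subset-enum _≟ˢ_ (ones w) powerValue
      coefficient≡ : coefficient ≡ coeff w
      coefficient≡ = ∏*.∑-δ (Word-enum m) _≟ʷ_ w coeff

    splitTerm : Subset m → Subset m → ℚ
    splitTerm b c = logCoeff ∣ b ∣ * recip (∣ b ∣ ℕ.+ ∣ c ∣) * powerValue b * injectiveSum a′ c

    wordValue-term : ∀ w → hasOne w ≡ true → wordValue w ≡ splitTerm (ones w) (twos w)
    wordValue-term w has =
      cong₂ (λ t k → if t then k * powerValue (ones w) * injectiveSum a′ (twos w) else injectiveSum a′ (twos w))
            has (cong (λ t → if t then logCoeff ∣ ones w ∣ * recip (∣ ones w ∣ ℕ.+ ∣ twos w ∣) else δ (twos w)) has)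

    splitTerm-∅ : ∀ w → hasOne w ≡ false → splitTerm (ones w) (twos w) ≡ 0ℚ
    splitTerm-∅ w no-one =
      trans (cong (λ k → logCoeff k * recip (k ℕ.+ ∣ twos w ∣) * powerValue (ones w) * injectiveSum a′ (twos w))
                  (∣ones∣≡0 w no-one))
            (solve 3 (λ r p s → con 0ℚ :* r :* p :* s := con 0ℚ) refl
                   (recip ∣ twos w ∣) (powerValue (ones w)) (injectiveSum a′ (twos w)))

    raise-children : ∀ v w′ → (if hasOne w′ ∧ does (raise w′ ≟ʷ v) then wordValue w′ else 0ℚ)
                              ≡ (if does (raise w′ ≟ʷ v) then splitTerm (ones w′) (twos w′) else 0ℚ)
    raise-children v w′ = by-cases (hasOne w′) refl (does (raise w′ ≟ʷ v))
      where
      by-cases : ∀ t → hasOne w′ ≡ t → ∀ r →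
                 (if t ∧ r then wordValue w′ else 0ℚ) ≡ (if r then splitTerm (ones w′) (twos w′) else 0ℚ)
      by-cases true  has    true  = wordValue-term w′ has
      by-cases true  _      false = refl
      by-cases false no-one true  = sym (splitTerm-∅ w′ no-one)
      by-cases false _      false = refl

    powerValue-nonempty : ∀ b → isEmpty b ≡ false → powerValue b ≡ powerSum a′ b
    powerValue-nonempty b nonempty = begin
        powerValue b
      ≡⟨ ∑+.sum-cong-≗ (λ j → cong (λ t → if t then 0ℚ else monomial (column a′ j) b) nonempty) ⟩
        ∑+.sum (λ j → monomial (column a′ j) b)
      ≡⟨ ∑+.foldr-tabulate (λ j → monomial (column a′ j) b) id ⟨
        powerSum a′ b
      ∎
      where open ≡-Reasoning

    logCoeff-powerValue : ∀ b → logCoeff ∣ b ∣ * powerValue b ≡ logSum a′ b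
    logCoeff-powerValue b = by-size ∣ b ∣ refl
      where
      by-size : ∀ k → ∣ b ∣ ≡ k → logCoeff ∣ b ∣ * powerValue b ≡ logCoeff ∣ b ∣ * powerSum a′ b
      by-size zero    ∣b∣≡0 = trans (cong (λ k → logCoeff k * powerValue b) ∣b∣≡0)
                                    (trans (*-zeroˡ (powerValue b))
                                           (sym (trans (cong (λ k → logCoeff k * powerSum a′ b) ∣b∣≡0) (*-zeroˡ (powerSum a′ b)))))
      by-size (suc k) ∣b∣≡k = cong (logCoeff ∣ b ∣ *_) (powerValue-nonempty b (cong (ℕ._≡ᵇ 0) ∣b∣≡k))

    sumSplits-splitTerm : ∀ D → sumSplits splitTerm D ≡ recip ∣ D ∣ * (logSum a′ ⋆ injectiveSum a′) D
    sumSplits-splitTerm D = begin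
        sumSplits splitTerm D
      ≡⟨ sumSplits-cong reassociate D ⟩
        sumSplits (λ b c → recip (∣ b ∣ ℕ.+ ∣ c ∣) * (logSum a′ b * injectiveSum a′ c)) D
      ≡⟨ sumSplits-weight recip (λ b c → logSum a′ b * injectiveSum a′ c) D ⟩
        recip ∣ D ∣ * (logSum a′ ⋆ injectiveSum a′) D
      ∎
      where
      open ≡-Reasoning
      reassociate : ∀ b c → splitTerm b c ≡ recip (∣ b ∣ ℕ.+ ∣ c ∣) * (logSum a′ b * injectiveSum a′ c)
      reassociate b c =
        trans (solve 4 (λ e r p s → e :* r :* p :* s := r :* (e :* p :* s)) refl
                     (logCoeff ∣ b ∣) (recip (∣ b ∣ ℕ.+ ∣ c ∣)) (powerValue b) (injectiveSum a′ c))
              (cong (λ x → recip (∣ b ∣ ℕ.+ ∣ c ∣) * (x * injectiveSum a′ c)) (logCoeff-powerValue b))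

    raised-sum : ∀ w → hasOne w ≡ false →
                 ∑+.∑⟨ Word-enum m ⟩ (λ w′ → if edge (wordG w′) (wordG w) then wordValue w′ else 0ℚ)
                 ≡ recip ∣ twos w ∣ * (logSum a′ ⋆ injectiveSum a′) (twos w)
    raised-sum w no-one = begin
        ∑+.∑⟨ Word-enum m ⟩ (λ w′ → if edge (wordG w′) (wordG w) then wordValue w′ else 0ℚ)
      ≡⟨ ∑+.∑-cong (Word-enum m) (λ w′ → cong (λ t → if t then wordValue w′ else 0ℚ) (edge-into-subset w no-one w′)) ⟩
        ∑+.∑⟨ Word-enum m ⟩ (λ w′ → if hasOne w′ ∧ does (raise w′ ≟ʷ w) then wordValue w′ else 0ℚ)
      ≡⟨ ∑+.∑-cong (Word-enum m) (raise-children w) ⟩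
        ∑+.∑⟨ Word-enum m ⟩ (λ w′ → if does (raise w′ ≟ʷ w) then splitTerm (ones w′) (twos w′) else 0ℚ)
      ≡⟨ cong (λ v → ∑+.∑⟨ Word-enum m ⟩ (λ w′ → if does (raise w′ ≟ʷ v) then splitTerm (ones w′) (twos w′) else 0ℚ))
              (twosWord-twos w no-one) ⟨
        ∑+.∑⟨ Word-enum m ⟩ (λ w′ → if does (raise w′ ≟ʷ twosWord (twos w)) then splitTerm (ones w′) (twos w′) else 0ℚ)
      ≡⟨ ∑-raise splitTerm (twos w) ⟩
        sumSplits splitTerm (twos w)
      ≡⟨ sumSplits-splitTerm (twos w) ⟩
        recip ∣ twos w ∣ * (logSum a′ ⋆ injectiveSum a′) (twos w)
      ∎
      where open ≡-Reasoning

    subset-children : ∀ w → hasOne w ≡ false → ∑children (wordG w) ≡ wordValue w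
    subset-children w no-one = begin
        ∑children (wordG w)
      ≡⟨ GateSum.∑-Gate +-0-isCommutativeMonoid (λ h → if edge h (wordG w) then value h else 0ℚ) ⟩
        ∑+.∑⟨ Input-enum ⟩ (λ _ → 0ℚ) + (∑+.∑⟨ Mono-enum ⟩ (λ _ → 0ℚ) + (power + (coefficient +
          ∑+.∑⟨ Word-enum m ⟩ (λ w′ → if edge (wordG w′) (wordG w) then wordValue w′ else 0ℚ))))
      ≡⟨ cong₂ _+_ (∑+.∑-ε Input-enum (λ _ → refl)) (cong₂ _+_ (∑+.∑-ε Mono-enum (λ _ → refl))
                     (cong₂ _+_ power≡ (cong₂ _+_ coefficient≡ (raised-sum w no-one)))) ⟩
        0ℚ + (0ℚ + (0ℚ + (δ D + recip ∣ D ∣ * (logSum a′ ⋆ injectiveSum a′) D)))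
      ≡⟨ solve 1 (λ x → con 0ℚ :+ (con 0ℚ :+ (con 0ℚ :+ x)) := x) refl
               (δ D + recip ∣ D ∣ * (logSum a′ ⋆ injectiveSum a′) D) ⟩
        δ D + recip ∣ D ∣ * (logSum a′ ⋆ injectiveSum a′) D
      ≡⟨ newton a′ D ⟨
        injectiveSum a′ D
      ≡⟨ cong (λ t → if t then coeff w * powerValue (ones w) * injectiveSum a′ D else injectiveSum a′ D) no-one ⟨
        wordValue w
      ∎
      where
      open ≡-Reasoning
      D : Subset m
      D = twos w
      power coefficient : ℚ
      power       = ∑+.∑⟨ Subset-enum ⟩ (λ b → if does (b ≟ˢ ones w) then powerValue b else 0ℚ)
      coefficient = ∑+.∑⟨ Word-enum m ⟩ (λ w′ → if does (w′ ≟ʷ w) then coeff w′ else 0ℚ)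
      power≡ : power ≡ 0ℚ
      power≡ = trans (∑+.∑-δ Subset-enum _≟ˢ_ (ones w) powerValue)
                     (powerValue-∅ (ones w) (trans (sym (not-involutive _)) (cong not no-one)))
      coefficient≡ : coefficient ≡ δ D
      coefficient≡ = trans (∑+.∑-δ (Word-enum m) _≟ʷ_ w coeff)
                           (cong (λ t → if t then logCoeff ∣ ones w ∣ * recip (∣ ones w ∣ ℕ.+ ∣ D ∣) else δ D) no-one)

    if-label-≢ : ∀ t (l₁ l₂ : Label (Var n)) {l} → l₁ ≢ l → l₂ ≢ l → (if t then l₁ else l₂) ≢ l
    if-label-≢ true  _ _ l₁≢l _    = l₁≢l
    if-label-≢ false _ _ _    l₂≢l = l₂≢l

    var-eq : ∀ g v → label g ≡ var v → value g ≡ a v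
    var-eq (inputG i j) v refl = refl
    var-eq (monoG b j)  v eq   = ⊥-elim (if-label-≢ (isEmpty b) (const 0ℚ) times (λ ()) (λ ()) eq)
    var-eq (wordG w)    v eq   = ⊥-elim (if-label-≢ (hasOne w) times plus (λ ()) (λ ()) eq)

    const-eq : ∀ g q → label g ≡ const q → value g ≡ q
    const-eq (monoG b j) q eq   = by-cases (isEmpty b) refl eq
      where
      by-cases : ∀ t → isEmpty b ≡ t → (if t then const 0ℚ else times) ≡ const {Var n} q → monoValue b j ≡ q
      by-cases true empty refl = cong (λ t → if t then 0ℚ else monomial (column a′ j) b) empty
    const-eq (coeffG w)  q refl = refl
    const-eq (wordG w)   q eq   = ⊥-elim (if-label-≢ (hasOne w) times plus (λ ()) (λ ()) eq)

    plus-eq : ∀ g → label g ≡ plus → ∑children g ≡ value g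
    plus-eq (monoG b j) eq = ⊥-elim (if-label-≢ (isEmpty b) (const 0ℚ) times (λ ()) (λ ()) eq)
    plus-eq (powerG b)  _  = power-children b
    plus-eq (wordG w)   eq = by-cases (hasOne w) refl eq
      where
      by-cases : ∀ t → hasOne w ≡ t → (if t then times else plus) ≡ plus {Var n} → ∑children (wordG w) ≡ wordValue w
      by-cases false no-one _ = subset-children w no-one

    times-eq : ∀ g → label g ≡ times → ∏children g ≡ value g
    times-eq (monoG b j) eq = by-cases (isEmpty b) refl eq
      where
      by-cases : ∀ t → isEmpty b ≡ t → (if t then const 0ℚ else times) ≡ times {Var n} → ∏children (monoG b j) ≡ monoValue b j
      by-cases false nonempty _ = mono-children b j nonempty
    times-eq (wordG w)   eq = by-cases (hasOne w) refl eq
      where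
      by-cases : ∀ t → hasOne w ≡ t → (if t then times else plus) ≡ times {Var n} → ∏children (wordG w) ≡ wordValue w
      by-cases true has _ = term-children w has

    equations : GateEquations Gate-enum label edge a value
    equations = record { var-eq = var-eq ; const-eq = const-eq ; plus-eq = plus-eq ; times-eq = times-eq }

    value-twosWord : ∀ D → value (wordG (twosWord D)) ≡ injectiveSum a′ D
    value-twosWord D =
      trans (cong (λ t → if t then coeff (twosWord D) * powerValue (ones (twosWord D)) * injectiveSum a′ (twos (twosWord D))
                              else injectiveSum a′ (twos (twosWord D))) (hasOne-twosWord D))
            (cong (injectiveSum a′) (twos-twosWord D))

  circuit : Circuit (Var n) (size Gate-enum)
  circuit = EnumeratedCircuit.circuit gates

  circuit-B : ∀ D a → eval circuit a (index Gate-enum (wordG (twosWord D))) ≡ B D a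
  circuit-B D a = begin
      eval circuit a (index Gate-enum (wordG (twosWord D)))
    ≡⟨ eval-equations circuit a (EnumeratedCircuit.circuit-equations gates equations) (index Gate-enum (wordG (twosWord D))) ⟩
      value (element Gate-enum (index Gate-enum (wordG (twosWord D))))
    ≡⟨ cong value (element-index Gate-enum (wordG (twosWord D))) ⟩
      value (wordG (twosWord D))
    ≡⟨ value-twosWord D ⟩
      B D a
    ∎
    where
    open ≡-Reasoning
    open Evaluation a

  symmetric : Symmetric circuit
  symmetric π σ = automorphism⇒extendsTo (automorphism π σ)

  size-Gate-enum : size Gate-enum ≡ m ℕ.* n ℕ.+ (2 ^ m ℕ.* n ℕ.+ (2 ^ m ℕ.+ (3 ^ m ℕ.+ 3 ^ m)))
  size-Gate-enum rewrite size-Vec-enum Bool-enum m | size-Vec-enum (Fin-enum 3) m = refl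

  size-Gate-enum≤ : size Gate-enum ℕ.≤ 16 ℕ.* 3 ^ n
  size-Gate-enum≤ = subst (ℕ._≤ 16 ℕ.* 3 ^ n) (sym size-Gate-enum) (GateCount.gateCount≤16*3^n n)

lemmaC11 : Σ ℕ λ c → (n : ℕ) → 1 ℕ.≤ n →
    Σ ℕ λ s → s ℕ.≤ c ℕ.* 3 ^ n × Σ (Circuit (Var n) s) λ C →
    Symmetric C ×
    ((D : Vec Bool (suc n)) → Σ (Fin s) λ g → (a : Var n → ℚ) → eval C a g ≡ B D a)
lemmaC11 = 16 , λ where
  (suc n′) _ → let open Construction n′ in
    size Gate-enum , size-Gate-enum≤ , circuit , symmetric , λ D → index Gate-enum (wordG (twosWord D)) , circuit-B D
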